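{- Let $C_{\lambda,\mu}$ be a conjugacy class of $B_n$. For any $i\in[n]$, \[\mathbb{E}_{\lambda,\mu}[\operatorname{inv}_{ -i,i}]=\Pr_{\lambda,\mu}[\operatorname{inv}_{ -i,i}=1]=\frac12-\frac{\Delta^1(\lambda,\mu)}{2n}.\]
   Context: $B_n$ is the group of permutations $\omega$ of $\{\pm1,\dots,\pm n\}$ with $\omega(-i)=-\omega(i)$. A cycle of $\omega$ is a cycle of $|\omega|:i\mapsto|\omega(i)|$; it is even (odd) if the number of its elements $i$ with $\omega(i)<0$ is even (odd). The cycle type is the bi-partition $(\lambda,\mu)$ with $\lambda$ the lengths of even cycles and $\mu$ those of odd cycles; $C_{\lambda,\mu}$ is the conjugacy class of that type, and $\Pr_{\lambda,\mu},\mathbb{E}_{\lambda,\mu}$ refer to the uniform distribution on it. $m_1(\lambda)$ (resp. $m_1(\mu)$) is the number of parts equal to $1$ in $\lambda$ (resp. $\mu$), and $\Delta^1(\lambda,\mu)=m_1(\lambda)-m_1(\mu)$. $\operatorname{inv}_{ -i,i}$ is the indicator that $\omega(i)<\omega(-i)$, equivalently $\omega(i)<0$. -}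

module Defs where

open import Data.Bool using (Bool; true; false; _∧_; _∨_; not; if_then_else_)
open import Data.Nat using (ℕ; zero; suc; _+_; _*_; _≤ᵇ_; _≡ᵇ_)
open import Data.Fin using (Fin; toℕ)
open import Data.Fin.Properties using () renaming (_≟_ to _≟ᶠ_)
open import Data.Vec using (Vec; []; _∷_; lookup)
open import Data.List using (List; []; _∷_; [_]; map; concatMap; filter; filterᵇ; length; upTo; allFin; all; _++_)
open import Data.Integer using (ℤ; +_) renaming (_-_ to _-ℤ_)
open import Data.Rational using (ℚ; 0ℚ; _/_)
open import Data.Product using (_×_; _,_; proj₁; proj₂)
open import Relation.Nullary using (does)
import Data.Nat as ℕ

-- A signed permutation ω ∈ B_n, stored literally as the pair
--   ( |ω| as the vector (|ω(1)|,…,|ω(n)|) ,  the vector of flags [ω(i) < 0] ).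
-- (ω(i) = ± |ω|(i) according to the flag, and ω(-i) = -ω(i).)
-- Elements of [n] are 0-indexed as Fin n.
Raw : ℕ → Set
Raw n = Vec (Fin n) n × Vec Bool n

absPart : ∀ {n} → Raw n → Fin n → Fin n
absPart ω i = lookup (proj₁ ω) i

-- ω(i) < 0   (equivalently ω(i) < ω(-i)), i.e. inv_{-i,i}(ω) = 1
negAt : ∀ {n} → Raw n → Fin n → Bool
negAt ω i = lookup (proj₂ ω) i

allVec : ∀ {A : Set} → List A → (k : ℕ) → List (Vec A k)
allVec xs zero    = [ [] ]
allVec xs (suc k) = concatMap (λ x → map (x ∷_) (allVec xs k)) xs

-- |ω| is a bijection of [n] (injective map of a finite set to itself)
injectiveᵇ : ∀ {n} → Vec (Fin n) n → Bool
injectiveᵇ {n} v =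
  all (λ i → all (λ j → not (does (lookup v i ≟ᶠ lookup v j)) ∨ does (i ≟ᶠ j)) (allFin n)) (allFin n)

isSignedPerm : ∀ {n} → Raw n → Bool
isSignedPerm ω = injectiveᵇ (proj₁ ω)

Bn : (n : ℕ) → List (Raw n)
Bn n = filterᵇ isSignedPerm
         (concatMap (λ v → map (λ s → (v , s)) (allVec (true ∷ false ∷ []) n)) (allVec (allFin n) n))

iter : ∀ {n} → (Fin n → Fin n) → ℕ → Fin n → Fin n
iter σ zero    i = i
iter σ (suc k) i = σ (iter σ k i)

cycleLen : ∀ {n} → (Fin n → Fin n) → Fin n → ℕ
cycleLen {n} σ i = go n 1
  where
  go : ℕ → ℕ → ℕ
  go zero    k = k
  go (suc f) k = if does (iter σ k i ≟ᶠ i) then k else go f (suc k)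

orbit : ∀ {n} → (Fin n → Fin n) → Fin n → List (Fin n)
orbit σ i = map (λ k → iter σ k i) (upTo (cycleLen σ i))

-- i is the smallest element of its cycle (one representative per cycle)
isLeader : ∀ {n} → (Fin n → Fin n) → Fin n → Bool
isLeader σ i = all (λ j → toℕ i ≤ᵇ toℕ j) (orbit σ i)

negCount : ∀ {n} → Raw n → Fin n → ℕ
negCount ω i = length (filterᵇ (negAt ω) (orbit (absPart ω) i))

evenᵇ : ℕ → Bool
evenᵇ zero          = true
evenᵇ (suc zero)    = false
evenᵇ (suc (suc k)) = evenᵇ k

-- λ : lengths of even cycles,  μ : lengths of odd cycles (as unordered lists)
evenCycleLengths : ∀ {n} → Raw n → List ℕ
evenCycleLengths {n} ω =
  map (cycleLen (absPart ω)) (filterᵇ (λ i → isLeader (absPart ω) i ∧ evenᵇ (negCount ω i)) (allFin n))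

oddCycleLengths : ∀ {n} → Raw n → List ℕ
oddCycleLengths {n} ω =
  map (cycleLen (absPart ω)) (filterᵇ (λ i → isLeader (absPart ω) i ∧ not (evenᵇ (negCount ω i))) (allFin n))

countℕ : ℕ → List ℕ → ℕ
countℕ k xs = length (filterᵇ (λ x → x ≡ᵇ k) xs)

sameMultiset : List ℕ → List ℕ → Bool
sameMultiset xs ys = all (λ k → countℕ k xs ≡ᵇ countℕ k ys) (xs ++ ys)

hasCycleType : ∀ {n} → List ℕ → List ℕ → Raw n → Bool
hasCycleType la mu ω = sameMultiset (evenCycleLengths ω) la ∧ sameMultiset (oddCycleLengths ω) mu

conjClass : (n : ℕ) → List ℕ → List ℕ → List (Raw n)
conjClass n la mu = filterᵇ (hasCycleType la mu) (Bn n)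

m₁ : List ℕ → ℕ
m₁ xs = length (filterᵇ (λ k → k ≡ᵇ 1) xs)

Δ¹ : List ℕ → List ℕ → ℤ
Δ¹ la mu = (+ m₁ la) -ℤ (+ m₁ mu)

-- the rational number p / d (with the convention p / 0 = 0, never used below)
frac : ℤ → ℕ → ℚ
frac p zero    = 0ℚ
frac p (suc d) = p / suc d

-- Pr_{λ,μ}[inv_{-i,i} = 1] = #{ω ∈ C_{λ,μ} : ω(i) < 0} / |C_{λ,μ}|
-- (this is also E_{λ,μ}[inv_{-i,i}], the mean of the 0/1 indicator)
probNeg : (n : ℕ) → List ℕ → List ℕ → Fin n → ℚ
probNeg n la mu i = frac (+ length (filterᵇ (λ ω → negAt ω i) (conjClass n la mu))) (length (conjClass n la mu))

module Submission where

-- Let N = |C_{λ,μ}|, F±(j) the number of ω ∈ C_{λ,μ} fixing j with sign ±, and M± the number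
-- with i not fixed and ω(i) of sign ±. Toggling the signs at i and at its preimage keeps every
-- cycle parity, so it is an involution of C_{λ,μ} exchanging the two kinds: M₋ = M₊.
-- Conjugating by the transposition (i j) gives F±(j) = F±(i); since a fixed point is an odd
-- 1-cycle iff its sign is negative, double counting yields n F₋(i) = N m₁(μ) and n F₊(i) = N m₁(λ).
-- With N = F₋ + F₊ + 2 M₋ this gives Pr[ω(i) < 0] = (F₋ + M₋)/N = ½ − (m₁(λ) − m₁(μ))/(2n),
-- provided N ≠ 0, which is witnessed by an explicit product of cycles of the prescribed type.

open import Defs
open import Data.Bool using (Bool; true; false; T; _∧_; _∨_; not; if_then_else_; _xor_)
open import Data.Bool.Properties using (∧-zeroʳ; ∧-identityʳ; not-involutive; xor-same; xor-identityʳ; xor-assoc)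
open import Data.Empty using (⊥-elim)
import Data.Integer as ℤ
open import Data.Fin using (Fin; zero; suc; toℕ; fromℕ; inject₁; _↑ˡ_; _↑ʳ_; splitAt; join)
open import Data.Fin.Properties using (pigeonhole; toℕ<n; toℕ-injective; toℕ-fromℕ; toℕ-inject₁; inject₁-injective; splitAt-↑ˡ; splitAt-↑ʳ; splitAt-join; join-splitAt; ↑ˡ-injective; ↑ʳ-injective) renaming (_≟_ to _≟ᶠ_)
import Data.List
open import Data.List using (List; []; _∷_; map; concatMap; filterᵇ; length; upTo; allFin; all; _++_)
import Data.List.Membership.DecPropositional as DecMembership
open import Data.List.Membership.Propositional using (_∈_; _∉_; find; lose)
open import Data.List.Membership.Propositional.Properties using (∈-map⁺; ∈-map⁻; ∈-upTo⁺; ∈-upTo⁻; ∈-allFin; ∈-++⁺ˡ; ∈-++⁺ʳ; ∈-concatMap⁺; ∈-concatMap⁻; ∈-filter⁺; ∈-filter⁻)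
open import Data.List.Properties using (map-upTo; length-map; length-applyUpTo; length-tabulate; map-cong; map-∘)
open import Data.List.Extrema.Nat using (argmin; argmin-all; f[argmin]≤f[xs])
open import Data.List.Relation.Unary.All as All using (All; []; _∷_)
open import Data.List.Relation.Unary.All.Properties using (all⁺; all⁻; All¬⇒¬Any)
open import Data.List.Relation.Unary.Any using (here; there)
open import Data.List.Relation.Unary.Unique.Propositional using (Unique; []; _∷_)
open import Data.List.Relation.Unary.Unique.Propositional.Properties using (applyUpTo⁺₁; allFin⁺; map⁺; ++⁺; filter⁺)
open import Data.Nat using (ℕ; zero; suc; pred; _+_; _*_; _∸_; _≤_; _<_; s≤s; _≡ᵇ_)
open import Data.Nat.ListAction using (sum)
open import Data.Nat.Properties
open import Data.Rational using (ℚ; ½; _-_)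
open import Data.Product using (_×_; _,_; proj₁; proj₂; ∃)
open import Data.Sum using (inj₁; inj₂; [_,_]′)
open import Data.Vec using (Vec; []; _∷_; lookup; tabulate)
open import Data.Vec.Properties using (lookup∘tabulate; tabulate∘lookup; tabulate-cong)
open import Function.Definitions using (Injective)
open import Relation.Binary.Definitions using (DecidableEquality)
open import Relation.Binary.PropositionalEquality
open import Relation.Nullary using (Dec; does; yes; no; ¬_)
open import Relation.Nullary.Decidable using (dec-true; dec-false)

𝟙 : Bool → ℕ
𝟙 true  = 1
𝟙 false = 0

∑ : {A : Set} → List A → (A → ℕ) → ℕ
∑ []       f = 0
∑ (x ∷ xs) f = f x + ∑ xs f

length-filterᵇ : {A : Set} (p : A → Bool) (xs : List A) → length (filterᵇ p xs) ≡ ∑ xs (λ x → 𝟙 (p x))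
length-filterᵇ p [] = refl
length-filterᵇ p (x ∷ xs) with p x
... | true  = cong suc (length-filterᵇ p xs)
... | false = length-filterᵇ p xs

∑-cong : {A : Set} (xs : List A) {f g : A → ℕ} → (∀ x → f x ≡ g x) → ∑ xs f ≡ ∑ xs g
∑-cong []       f≗g = refl
∑-cong (x ∷ xs) f≗g = cong₂ _+_ (f≗g x) (∑-cong xs f≗g)

∑-cong-∈ : {A : Set} (xs : List A) {f g : A → ℕ} → (∀ x → x ∈ xs → f x ≡ g x) → ∑ xs f ≡ ∑ xs g
∑-cong-∈ []       f≗g = refl
∑-cong-∈ (x ∷ xs) f≗g = cong₂ _+_ (f≗g x (here refl)) (∑-cong-∈ xs (λ y p → f≗g y (there p)))

∑-++ : {A : Set} (xs ys : List A) (f : A → ℕ) → ∑ (xs ++ ys) f ≡ ∑ xs f + ∑ ys f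
∑-++ []       ys f = refl
∑-++ (x ∷ xs) ys f = trans (cong (f x +_) (∑-++ xs ys f)) (sym (+-assoc (f x) _ _))

∑-map : {A B : Set} (g : A → B) (xs : List A) (f : B → ℕ) → ∑ (map g xs) f ≡ ∑ xs (λ x → f (g x))
∑-map g []       f = refl
∑-map g (x ∷ xs) f = cong (f (g x) +_) (∑-map g xs f)

∑-filterᵇ : {A : Set} (p : A → Bool) (xs : List A) (f : A → ℕ) →
  ∑ (filterᵇ p xs) f ≡ ∑ xs (λ x → if p x then f x else 0)
∑-filterᵇ p []       f = refl
∑-filterᵇ p (x ∷ xs) f with p x
... | true  = cong (f x +_) (∑-filterᵇ p xs f)
... | false = ∑-filterᵇ p xs f

∑-+ : {A : Set} (xs : List A) (f g : A → ℕ) → ∑ xs (λ x → f x + g x) ≡ ∑ xs f + ∑ xs g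
∑-+ []       f g = refl
∑-+ (x ∷ xs) f g = trans (cong (f x + g x +_) (∑-+ xs f g)) (+-interchange (f x) (g x) (∑ xs f) (∑ xs g))
  where open import Algebra.Properties.CommutativeSemigroup +-commutativeSemigroup renaming (interchange to +-interchange)

∑-distribˡ : {A : Set} (c : ℕ) (xs : List A) (f : A → ℕ) → ∑ xs (λ x → c * f x) ≡ c * ∑ xs f
∑-distribˡ c []       f = sym (*-zeroʳ c)
∑-distribˡ c (x ∷ xs) f = trans (cong (c * f x +_) (∑-distribˡ c xs f)) (sym (*-distribˡ-+ c (f x) (∑ xs f)))

∑-zero : {A : Set} (xs : List A) → ∑ xs (λ _ → 0) ≡ 0
∑-zero []       = refl
∑-zero (x ∷ xs) = ∑-zero xs

∑-const : {A : Set} (xs : List A) (c : ℕ) → ∑ xs (λ _ → c) ≡ c * length xs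
∑-const []       c = sym (*-zeroʳ c)
∑-const (x ∷ xs) c = trans (cong (c +_) (∑-const xs c)) (sym (*-suc c (length xs)))

∑-one : {A : Set} (xs : List A) → ∑ xs (λ _ → 1) ≡ length xs
∑-one xs = trans (∑-const xs 1) (*-identityˡ (length xs))

∑-comm : {A B : Set} (xs : List A) (ys : List B) (F : A → B → ℕ) →
  ∑ xs (λ a → ∑ ys (F a)) ≡ ∑ ys (λ b → ∑ xs (λ a → F a b))
∑-comm []       ys F = sym (∑-zero ys)
∑-comm (x ∷ xs) ys F = trans (cong (∑ ys (F x) +_) (∑-comm xs ys F)) (sym (∑-+ ys (F x) _))

∑-∈-≤ : {A : Set} (xs : List A) (f : A → ℕ) {x : A} → x ∈ xs → f x ≤ ∑ xs f
∑-∈-≤ (y ∷ xs) f (here refl) = m≤m+n (f y) (∑ xs f)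
∑-∈-≤ (y ∷ xs) f (there p)   = ≤-trans (∑-∈-≤ xs f p) (m≤n+m (∑ xs f) (f y))

module ∑-Unique {A : Set} (_≟_ : DecidableEquality A) where
  open import Data.List.Membership.DecPropositional _≟_ using (_∈?_)

  δ : A → A → ℕ → ℕ
  δ a x v = if does (a ≟ x) then v else 0

  ∑-δ-∉ : (xs : List A) (a : A) (g : A → ℕ) → a ∉ xs → ∑ xs (λ x → δ a x (g x)) ≡ 0
  ∑-δ-∉ []       a g a∉ = refl
  ∑-δ-∉ (x ∷ xs) a g a∉ with a ≟ x
  ... | yes refl = ⊥-elim (a∉ (here refl))
  ... | no  _    = ∑-δ-∉ xs a g (λ p → a∉ (there p))

  ∑-δ-∈ : (xs : List A) (a : A) (g : A → ℕ) → Unique xs → a ∈ xs → ∑ xs (λ x → δ a x (g x)) ≡ g a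
  ∑-δ-∈ (x ∷ xs) a g (x∉xs ∷ u) p with a ≟ x | p
  ... | yes refl | _        = trans (cong (g a +_) (∑-δ-∉ xs a g (All¬⇒¬Any x∉xs))) (+-identityʳ (g a))
  ... | no  a≢x  | here a≡x = ⊥-elim (a≢x a≡x)
  ... | no  _    | there q  = ∑-δ-∈ xs a g u q

  δ-sym : ∀ a x v → δ a x v ≡ δ x a v
  δ-sym a x v with a ≟ x | x ≟ a
  ... | yes _   | yes _   = refl
  ... | no  _   | no  _   = refl
  ... | yes a≡x | no x≢a  = ⊥-elim (x≢a (sym a≡x))
  ... | no  a≢x | yes x≡a = ⊥-elim (a≢x (sym x≡a))

  δ-subst : ∀ a x (g : A → ℕ) → δ a x (g x) ≡ δ a x (g a)
  δ-subst a x g with a ≟ x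
  ... | yes refl = refl
  ... | no  _    = refl

  -- Both sides equal the double sum ∑ₓ ∑_y [x = y] f y.
  ∑-sameMembers : (xs ys : List A) (f : A → ℕ) → Unique xs → Unique ys →
    (∀ z → z ∈ xs → z ∈ ys) → (∀ z → z ∈ ys → z ∈ xs) → ∑ xs f ≡ ∑ ys f
  ∑-sameMembers xs ys f uxs uys xs⊆ys ys⊆xs = begin
      ∑ xs f                                  ≡⟨ ∑-cong-∈ xs (λ x p → sym (∑-δ-∈ ys x f uys (xs⊆ys x p))) ⟩
      ∑ xs (λ x → ∑ ys (λ y → δ x y (f y)))  ≡⟨ ∑-cong xs (λ x → ∑-cong ys (λ y → trans (δ-subst x y f) (δ-sym x y (f x)))) ⟩
      ∑ xs (λ x → ∑ ys (λ y → δ y x (f x)))  ≡⟨ ∑-comm xs ys _ ⟩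
      ∑ ys (λ y → ∑ xs (λ x → δ y x (f x)))  ≡⟨ ∑-cong-∈ ys (λ y p → ∑-δ-∈ xs y f uxs (ys⊆xs y p)) ⟩
      ∑ ys f                                  ∎
    where open ≡-Reasoning

  ∑-restrict : (xs zs : List A) (f : A → ℕ) → Unique xs → Unique zs → (∀ z → z ∈ zs) →
    ∑ xs f ≡ ∑ zs (λ z → if does (z ∈? xs) then f z else 0)
  ∑-restrict xs zs f uxs uzs complete = begin
      ∑ xs f                                  ≡⟨ ∑-cong-∈ xs (λ x _ → sym (∑-δ-∈ zs x f uzs (complete x))) ⟩
      ∑ xs (λ x → ∑ zs (λ z → δ x z (f z)))  ≡⟨ ∑-comm xs zs _ ⟩
      ∑ zs (λ z → ∑ xs (λ x → δ x z (f z)))  ≡⟨ ∑-cong zs inner ⟩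
      ∑ zs (λ z → if does (z ∈? xs) then f z else 0) ∎
    where
    open ≡-Reasoning
    inner : ∀ z → ∑ xs (λ x → δ x z (f z)) ≡ (if does (z ∈? xs) then f z else 0)
    inner z with z ∈? xs
    ... | yes z∈ = trans (∑-cong xs (λ x → δ-sym x z (f z))) (∑-δ-∈ xs z (λ _ → f z) uxs z∈)
    ... | no  z∉ = trans (∑-cong xs (λ x → δ-sym x z (f z))) (∑-δ-∉ xs z (λ _ → f z) z∉)

search : (ℕ → Bool) → ℕ → ℕ → ℕ
search h zero    k = k
search h (suc f) k = if h k then k else search h f (suc k)

search-≥ : ∀ h f k → k ≤ search h f k
search-≥ h zero    k = ≤-refl
search-≥ h (suc f) k with h k
... | true  = ≤-refl
... | false = ≤-trans (n≤1+n k) (search-≥ h f (suc k))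

search-miss : ∀ h f k t → k ≤ t → t < search h f k → h t ≡ false
search-miss h zero    k t k≤t t< = ⊥-elim (<-irrefl refl (≤-trans t< k≤t))
search-miss h (suc f) k t k≤t t< with h k in hk
... | true  = ⊥-elim (<-irrefl refl (≤-trans t< k≤t))
... | false with k ≟ t
... | yes refl = hk
... | no  k≢t  = search-miss h f (suc k) t (≤∧≢⇒< k≤t k≢t) t<

search-hit : ∀ h f k → search h f k < f + k → h (search h f k) ≡ true
search-hit h zero    k s< = ⊥-elim (<-irrefl refl s<)
search-hit h (suc f) k s< with h k in hk
... | true  = hk
... | false = search-hit h f (suc k) (subst (search h f (suc k) <_) (sym (+-suc f k)) s<)

search-cong : ∀ h h' f k → (∀ t → h t ≡ h' t) → search h f k ≡ search h' f k
search-cong h h' zero    k h≗h' = refl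
search-cong h h' (suc f) k h≗h' rewrite h≗h' k with h' k
... | true  = refl
... | false = search-cong h h' f (suc k) h≗h'

search-first : ∀ h f k t → h t ≡ true → k ≤ t → t < f + k → (∀ u → k ≤ u → u < t → h u ≡ false) →
  search h f k ≡ t
search-first h zero    k t ht k≤t t< _ = ⊥-elim (<-irrefl refl (≤-trans t< k≤t))
search-first h (suc f) k t ht k≤t t< earlier with k ≟ t
... | yes refl rewrite ht = refl
... | no  k≢t  rewrite earlier k ≤-refl (≤∧≢⇒< k≤t k≢t) =
  search-first h f (suc k) t ht (≤∧≢⇒< k≤t k≢t) (subst (t <_) (sym (+-suc f k)) t<)
    (λ u k<u u<t → earlier u (≤-trans (n≤1+n k) k<u) u<t)

does-sound : ∀ {A : Set} (a? : Dec A) → does a? ≡ true → A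
does-sound (yes a) _ = a

iter-+ : ∀ {n} (σ : Fin n → Fin n) a b k → iter σ (a + b) k ≡ iter σ a (iter σ b k)
iter-+ σ zero    b k = refl
iter-+ σ (suc a) b k = cong σ (iter-+ σ a b k)

returnsAt : ∀ {n} → (Fin n → Fin n) → Fin n → ℕ → Bool
returnsAt σ i t = does (iter σ t i ≟ᶠ i)

-- `cycleLen` runs a local loop of Defs that cannot be named. The meta `cycleLoop` is solved to that
-- loop by unification in `cycleLen-unfold`, whose `with` turns `suc m` and `2` into variables so that
-- the constraint is a pattern.
mutual
  cycleLoop : ∀ {n} → (Fin n → Fin n) → Fin n → ℕ → ℕ → ℕ
  cycleLoop = _

  cycleLen-unfold : ∀ m (σ : Fin (suc m) → Fin (suc m)) i →
    cycleLen σ i ≡ (if does (σ i ≟ᶠ i) then 1 else cycleLoop σ i m 2)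
  cycleLen-unfold m σ i with suc m | 2
  ... | _ | _ = refl

cycleLoop-search : ∀ {n} (σ : Fin n → Fin n) i f k → cycleLoop σ i f k ≡ search (returnsAt σ i) f k
cycleLoop-search σ i zero    k = refl
cycleLoop-search σ i (suc f) k with returnsAt σ i k
... | true  = refl
... | false = cycleLoop-search σ i f (suc k)

cycleLen-search : ∀ {n} (σ : Fin n → Fin n) i → cycleLen σ i ≡ search (returnsAt σ i) n 1
cycleLen-search {n} σ i = cycleLoop-search σ i n 1

cycleLen-fixed : ∀ {n} (σ : Fin n → Fin n) j → does (σ j ≟ᶠ j) ≡ true → cycleLen σ j ≡ 1
cycleLen-fixed {suc m} σ j fixed = trans (cycleLen-unfold m σ j) (cong (λ c → if c then 1 else cycleLoop σ j m 2) fixed)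

cycleLen-moved : ∀ {n} (σ : Fin n → Fin n) j → does (σ j ≟ᶠ j) ≡ false → (cycleLen σ j ≡ᵇ 1) ≡ false
cycleLen-moved {suc m} σ j moved rewrite cycleLen-unfold m σ j | moved | cycleLoop-search σ j m 2
  with search (returnsAt σ j) m 2 | search-≥ (returnsAt σ j) m 2
... | suc (suc _) | _         = refl
... | suc zero    | s≤s ()

module Orbits {n : ℕ} (σ : Fin n → Fin n) (σ-inj : Injective _≡_ _≡_ σ) where
  open import Data.List.Membership.DecPropositional (_≟ᶠ_ {n}) using (_∈?_)
  open ∑-Unique (_≟ᶠ_ {n})

  len : Fin n → ℕ
  len = cycleLen σ

  iter-injective : ∀ t {a b} → iter σ t a ≡ iter σ t b → a ≡ b
  iter-injective zero    e = e
  iter-injective (suc t) e = iter-injective t (σ-inj e)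

  returns : ∀ k → ∃ λ d → 1 ≤ d × d ≤ n × iter σ d k ≡ k
  returns k with pigeonhole (n<1+n n) (λ (t : Fin (suc n)) → iter σ (toℕ t) k)
  ... | p , q , p<q , e = d , m<n⇒0<n∸m p<q , d≤n ,
        iter-injective (toℕ p) (trans (sym (trans (cong (λ t → iter σ t k) q≡p+d) (iter-+ σ (toℕ p) d k))) (sym e))
    where
    d = toℕ q ∸ toℕ p
    q≡p+d : toℕ q ≡ toℕ p + d
    q≡p+d = sym (m+[n∸m]≡n (<⇒≤ p<q))
    d≤n : d ≤ n
    d≤n = ≤-trans (m∸n≤m (toℕ q) (toℕ p)) (≤-pred (toℕ<n q))

  cycleLen-pos : ∀ k → 1 ≤ len k
  cycleLen-pos k rewrite cycleLen-search σ k = search-≥ (returnsAt σ k) n 1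

  iter-<cycleLen : ∀ k t → 1 ≤ t → t < len k → iter σ t k ≢ k
  iter-<cycleLen k t 1≤t t<len returned = true≢false (trans (sym (dec-true (iter σ t k ≟ᶠ k) returned))
    (search-miss (returnsAt σ k) n 1 t 1≤t (subst (t <_) (cycleLen-search σ k) t<len)))
    where
    true≢false : true ≢ false
    true≢false ()

  cycleLen-≤ : ∀ k → len k ≤ n
  cycleLen-≤ k with returns k
  ... | d , 1≤d , d≤n , back with len k ≤? d
  ... | yes len≤d = ≤-trans len≤d d≤n
  ... | no  len≰d = ⊥-elim (iter-<cycleLen k d 1≤d (≰⇒> len≰d) back)

  iter-cycleLen : ∀ k → iter σ (len k) k ≡ k
  iter-cycleLen k = does-sound (iter σ (len k) k ≟ᶠ k)
    (subst (λ t → returnsAt σ k t ≡ true) (sym (cycleLen-search σ k)) (search-hit (returnsAt σ k) n 1 found))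
    where
    found : search (returnsAt σ k) n 1 < n + 1
    found = subst (_< n + 1) (cycleLen-search σ k) (subst (len k <_) (+-comm 1 n) (s≤s (cycleLen-≤ k)))

  ∈orbit⁻ : ∀ {k j} → j ∈ orbit σ k → ∃ λ u → u < len k × iter σ u k ≡ j
  ∈orbit⁻ {k} p with ∈-map⁻ (λ t → iter σ t k) p
  ... | u , u∈ , e = u , ∈-upTo⁻ u∈ , sym e

  iter-∈orbit : ∀ k t → iter σ t k ∈ orbit σ k
  iter-∈orbit k zero    = ∈-map⁺ _ (∈-upTo⁺ (cycleLen-pos k))
  iter-∈orbit k (suc t) with ∈orbit⁻ (iter-∈orbit k t)
  ... | u , u<len , e with suc u <? len k
  ... | yes su<len = subst (_∈ orbit σ k) (cong σ e) (∈-map⁺ _ (∈-upTo⁺ su<len))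
  ... | no  su≮len = subst (_∈ orbit σ k) wraps (iter-∈orbit k zero)
    where
    wraps : k ≡ σ (iter σ t k)
    wraps = trans (sym (iter-cycleLen k))
      (trans (cong (λ s → iter σ s k) (sym (≤-antisym u<len (≮⇒≥ su≮len)))) (cong σ e))

  orbit-refl : ∀ k → k ∈ orbit σ k
  orbit-refl k = iter-∈orbit k 0

  orbit-sym : ∀ {k j} → j ∈ orbit σ k → k ∈ orbit σ j
  orbit-sym {k} {j} p with ∈orbit⁻ p
  ... | u , u<len , e = subst (_∈ orbit σ j) back (iter-∈orbit j (len k ∸ u))
    where
    open ≡-Reasoning
    back : iter σ (len k ∸ u) j ≡ k
    back = begin
      iter σ (len k ∸ u) j              ≡⟨ cong (iter σ (len k ∸ u)) (sym e) ⟩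
      iter σ (len k ∸ u) (iter σ u k)   ≡⟨ sym (iter-+ σ (len k ∸ u) u k) ⟩
      iter σ (len k ∸ u + u) k          ≡⟨ cong (λ s → iter σ s k) (m∸n+n≡m (<⇒≤ u<len)) ⟩
      iter σ (len k) k                  ≡⟨ iter-cycleLen k ⟩
      k                                 ∎

  orbit-trans : ∀ {k j l} → j ∈ orbit σ k → l ∈ orbit σ j → l ∈ orbit σ k
  orbit-trans {k} p q with ∈orbit⁻ p | ∈orbit⁻ q
  ... | u , _ , e | v , _ , f = subst (_∈ orbit σ k) (trans (iter-+ σ v u k) (trans (cong (iter σ v) e) f)) (iter-∈orbit k (v + u))

  orbit-unique : ∀ k → Unique (orbit σ k)
  orbit-unique k rewrite map-upTo (λ t → iter σ t k) (len k) = applyUpTo⁺₁ (λ t → iter σ t k) (len k) distinct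
    where
    distinct : ∀ {s t} → s < t → t < len k → iter σ s k ≢ iter σ t k
    distinct {s} {t} s<t t<len e = iter-<cycleLen k (t ∸ s) (m<n⇒0<n∸m s<t) (≤-trans (s≤s (m∸n≤m t s)) t<len)
      (iter-injective s (trans (sym (trans (cong (λ r → iter σ r k) (sym (m+[n∸m]≡n (<⇒≤ s<t)))) (iter-+ σ s (t ∸ s) k))) (sym e)))

  length-orbit : ∀ k → length (orbit σ k) ≡ len k
  length-orbit k = trans (length-map _ (upTo (len k))) (length-applyUpTo (λ t → t) (len k))

  ∑-orbit : ∀ k (f : Fin n → ℕ) → ∑ (orbit σ k) f ≡ ∑ (allFin n) (λ j → if does (j ∈? orbit σ k) then f j else 0)
  ∑-orbit k f = ∑-restrict (orbit σ k) (allFin n) f (orbit-unique k) (allFin⁺ n) ∈-allFin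

  ∑-orbit-cong : ∀ {k k'} → k' ∈ orbit σ k → (f : Fin n → ℕ) → ∑ (orbit σ k) f ≡ ∑ (orbit σ k') f
  ∑-orbit-cong {k} {k'} k'∈ f =
    trans (∑-orbit k f) (trans (∑-cong (allFin n) (λ j → cong (λ b → if b then f j else 0) (sameOrbit j))) (sym (∑-orbit k' f)))
    where
    sameOrbit : ∀ j → does (j ∈? orbit σ k) ≡ does (j ∈? orbit σ k')
    sameOrbit j with j ∈? orbit σ k | j ∈? orbit σ k'
    ... | yes _ | yes _ = refl
    ... | no  _ | no  _ = refl
    ... | yes a | no  b = ⊥-elim (b (orbit-trans (orbit-sym k'∈) a))
    ... | no  a | yes b = ⊥-elim (a (orbit-trans k'∈ b))

  cycleLen-orbit : ∀ {k k'} → k' ∈ orbit σ k → len k' ≡ len k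
  cycleLen-orbit {k} {k'} k'∈ = begin
    len k'                     ≡⟨ sym (length-orbit k') ⟩
    length (orbit σ k')        ≡⟨ sym (∑-one (orbit σ k')) ⟩
    ∑ (orbit σ k') (λ _ → 1)   ≡⟨ sym (∑-orbit-cong k'∈ (λ _ → 1)) ⟩
    ∑ (orbit σ k) (λ _ → 1)    ≡⟨ ∑-one (orbit σ k) ⟩
    length (orbit σ k)         ≡⟨ length-orbit k ⟩
    len k                      ∎
    where open ≡-Reasoning

≡true⇒T : ∀ {b} → b ≡ true → T b
≡true⇒T refl = _

T⇒≡true : ∀ {b} → T b → b ≡ true
T⇒≡true {true} _ = refl

∧-conjunctˡ : ∀ {a b} → (a ∧ b) ≡ true → a ≡ true
∧-conjunctˡ {true} _ = refl

∧-conjunctʳ : ∀ {a b} → (a ∧ b) ≡ true → b ≡ true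
∧-conjunctʳ {true} ab = ab

all-sound : {A : Set} (p : A → Bool) (xs : List A) → all p xs ≡ true → ∀ {x} → x ∈ xs → p x ≡ true
all-sound p xs all≡ x∈ = T⇒≡true (All.lookup (all⁺ p xs (≡true⇒T all≡)) x∈)

all-complete : {A : Set} (p : A → Bool) (xs : List A) → (∀ {x} → x ∈ xs → p x ≡ true) → all p xs ≡ true
all-complete p xs holds = T⇒≡true (all⁻ p (All.tabulate (λ x∈ → ≡true⇒T (holds x∈))))

cyclePoints : ∀ {n} → (Fin n → Fin n) → (Fin n → Bool) → ℕ → ℕ
cyclePoints {n} σ P m = ∑ (allFin n) (λ k → 𝟙 ((cycleLen σ k ≡ᵇ m) ∧ P k))

module Leaders {n : ℕ} (σ : Fin n → Fin n) (σ-inj : Injective _≡_ _≡_ σ) where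
  open Orbits σ σ-inj
  open ∑-Unique (_≟ᶠ_ {n})
  open import Data.List.Membership.DecPropositional (_≟ᶠ_ {n}) using (_∈?_)

  leader : Fin n → Fin n
  leader k = argmin toℕ k (orbit σ k)

  leader-∈orbit : ∀ k → leader k ∈ orbit σ k
  leader-∈orbit k = argmin-all toℕ (orbit-refl k) (All.tabulate (λ p → p))

  leader-≤ : ∀ k {j} → j ∈ orbit σ k → toℕ (leader k) ≤ toℕ j
  leader-≤ k = All.lookup (f[argmin]≤f[xs] k (orbit σ k))

  isLeader-leader : ∀ k → isLeader σ (leader k) ≡ true
  isLeader-leader k = all-complete _ (orbit σ (leader k))
    (λ p → T⇒≡true (≤⇒≤ᵇ (leader-≤ k (orbit-trans (leader-∈orbit k) p))))

  isLeader-≤ : ∀ {ℓ j} → isLeader σ ℓ ≡ true → j ∈ orbit σ ℓ → toℕ ℓ ≤ toℕ j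
  isLeader-≤ {ℓ} {j} lead p = ≤ᵇ⇒≤ (toℕ ℓ) (toℕ j) (≡true⇒T (all-sound _ (orbit σ ℓ) lead p))

  isLeader-unique : ∀ {k ℓ ℓ'} → isLeader σ ℓ ≡ true → k ∈ orbit σ ℓ → isLeader σ ℓ' ≡ true → k ∈ orbit σ ℓ' → ℓ ≡ ℓ'
  isLeader-unique lead k∈ lead' k∈' = toℕ-injective (≤-antisym
    (isLeader-≤ lead (orbit-trans k∈ (orbit-sym k∈')))
    (isLeader-≤ lead' (orbit-trans k∈' (orbit-sym k∈))))

  ledBy : Fin n → Fin n → Bool
  ledBy ℓ k = isLeader σ ℓ ∧ does (k ∈? orbit σ ℓ)

  ∑-ledBy : ∀ k → ∑ (allFin n) (λ ℓ → 𝟙 (ledBy ℓ k)) ≡ 1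
  ∑-ledBy k = trans (∑-cong (allFin n) onlyLeader) (∑-δ-∈ (allFin n) (leader k) (λ _ → 1) (allFin⁺ n) (∈-allFin (leader k)))
    where
    onlyLeader : ∀ ℓ → 𝟙 (ledBy ℓ k) ≡ δ (leader k) ℓ 1
    onlyLeader ℓ with isLeader σ ℓ in lead | k ∈? orbit σ ℓ | leader k ≟ᶠ ℓ
    ... | true  | yes _  | yes _    = refl
    ... | true  | yes k∈ | no  ≢ℓ   = ⊥-elim (≢ℓ (isLeader-unique (isLeader-leader k) (orbit-sym (leader-∈orbit k)) lead k∈))
    ... | true  | no  k∉ | yes refl = ⊥-elim (k∉ (orbit-sym (leader-∈orbit k)))
    ... | true  | no  _  | no  _    = refl
    ... | false | _      | no  _    = refl
    ... | false | _      | yes refl with () ← trans (sym (isLeader-leader k)) lead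

  -- Every point lies on the cycle of exactly one leader.
  ∑-byLeaders : (Q : Fin n → ℕ) → (∀ k k' → k' ∈ orbit σ k → Q k' ≡ Q k) →
    ∑ (allFin n) Q ≡ ∑ (allFin n) (λ ℓ → if isLeader σ ℓ then Q ℓ * len ℓ else 0)
  ∑-byLeaders Q Q-const = begin
      ∑ (allFin n) Q                                                ≡⟨ ∑-cong (allFin n) spread ⟩
      ∑ (allFin n) (λ k → ∑ (allFin n) (λ ℓ → Q k * 𝟙 (ledBy ℓ k))) ≡⟨ ∑-comm (allFin n) (allFin n) _ ⟩
      ∑ (allFin n) (λ ℓ → ∑ (allFin n) (λ k → Q k * 𝟙 (ledBy ℓ k))) ≡⟨ ∑-cong (allFin n) collect ⟩
      ∑ (allFin n) (λ ℓ → if isLeader σ ℓ then Q ℓ * len ℓ else 0)  ∎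
    where
    open ≡-Reasoning
    spread : ∀ k → Q k ≡ ∑ (allFin n) (λ ℓ → Q k * 𝟙 (ledBy ℓ k))
    spread k = sym (trans (∑-distribˡ (Q k) (allFin n) _) (trans (cong (Q k *_) (∑-ledBy k)) (*-identityʳ (Q k))))
    onOrbit : ∀ ℓ k → Q k * 𝟙 (does (k ∈? orbit σ ℓ)) ≡ (if does (k ∈? orbit σ ℓ) then Q ℓ else 0)
    onOrbit ℓ k with k ∈? orbit σ ℓ
    ... | yes k∈ = trans (*-identityʳ (Q k)) (Q-const ℓ k k∈)
    ... | no  _  = *-zeroʳ (Q k)
    collect : ∀ ℓ → ∑ (allFin n) (λ k → Q k * 𝟙 (ledBy ℓ k)) ≡ (if isLeader σ ℓ then Q ℓ * len ℓ else 0)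
    collect ℓ with isLeader σ ℓ
    ... | false = trans (∑-cong (allFin n) (λ k → *-zeroʳ (Q k))) (∑-zero (allFin n))
    ... | true  = begin
      ∑ (allFin n) (λ k → Q k * 𝟙 (does (k ∈? orbit σ ℓ)))             ≡⟨ ∑-cong (allFin n) (onOrbit ℓ) ⟩
      ∑ (allFin n) (λ k → if does (k ∈? orbit σ ℓ) then Q ℓ else 0)    ≡⟨ sym (∑-orbit ℓ (λ _ → Q ℓ)) ⟩
      ∑ (orbit σ ℓ) (λ _ → Q ℓ)                                         ≡⟨ ∑-const (orbit σ ℓ) (Q ℓ) ⟩
      Q ℓ * length (orbit σ ℓ)                                          ≡⟨ cong (Q ℓ *_) (length-orbit ℓ) ⟩
      Q ℓ * len ℓ                                                       ∎

  cycleLengths : (Fin n → Bool) → List ℕ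
  cycleLengths P = map len (filterᵇ (λ ℓ → isLeader σ ℓ ∧ P ℓ) (allFin n))

  count-cycleLengths : (P : Fin n → Bool) → (∀ k k' → k' ∈ orbit σ k → P k' ≡ P k) →
    ∀ m → m * countℕ m (cycleLengths P) ≡ cyclePoints σ P m
  count-cycleLengths P P-const m = begin
      m * countℕ m (cycleLengths P)                                            ≡⟨ cong (m *_) (length-filterᵇ _ (cycleLengths P)) ⟩
      m * ∑ (cycleLengths P) (λ l → 𝟙 (l ≡ᵇ m))                               ≡⟨ cong (m *_) (∑-map len (filterᵇ _ (allFin n)) _) ⟩
      m * ∑ (filterᵇ (λ ℓ → isLeader σ ℓ ∧ P ℓ) (allFin n)) (λ ℓ → 𝟙 (len ℓ ≡ᵇ m)) ≡⟨ cong (m *_) (∑-filterᵇ _ (allFin n) _) ⟩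
      m * ∑ (allFin n) (λ ℓ → if isLeader σ ℓ ∧ P ℓ then 𝟙 (len ℓ ≡ᵇ m) else 0) ≡⟨ sym (∑-distribˡ m (allFin n) _) ⟩
      ∑ (allFin n) (λ ℓ → m * (if isLeader σ ℓ ∧ P ℓ then 𝟙 (len ℓ ≡ᵇ m) else 0)) ≡⟨ ∑-cong (allFin n) perLeader ⟩
      ∑ (allFin n) (λ ℓ → if isLeader σ ℓ then Q ℓ * len ℓ else 0)              ≡⟨ sym (∑-byLeaders Q Q-const) ⟩
      cyclePoints σ P m                                                         ∎
    where
    open ≡-Reasoning
    Q : Fin n → ℕ
    Q k = 𝟙 ((len k ≡ᵇ m) ∧ P k)
    Q-const : ∀ k k' → k' ∈ orbit σ k → Q k' ≡ Q k
    Q-const k k' k'∈ rewrite cycleLen-orbit k'∈ | P-const k k' k'∈ = refl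
    perLeader : ∀ ℓ → m * (if isLeader σ ℓ ∧ P ℓ then 𝟙 (len ℓ ≡ᵇ m) else 0) ≡ (if isLeader σ ℓ then Q ℓ * len ℓ else 0)
    perLeader ℓ with isLeader σ ℓ | P ℓ | len ℓ ≡ᵇ m in len≡m
    ... | false | _     | _     = *-zeroʳ m
    ... | true  | false | true  = *-zeroʳ m
    ... | true  | false | false = *-zeroʳ m
    ... | true  | true  | false = *-zeroʳ m
    ... | true  | true  | true  rewrite ≡ᵇ⇒≡ (len ℓ) m (≡true⇒T len≡m) = trans (*-identityʳ m) (sym (+-identityʳ m))

  countℕ-zero-cycleLengths : (P : Fin n → Bool) → countℕ 0 (cycleLengths P) ≡ 0
  countℕ-zero-cycleLengths P = begin
      countℕ 0 (cycleLengths P)                                ≡⟨ length-filterᵇ _ (cycleLengths P) ⟩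
      ∑ (cycleLengths P) (λ l → 𝟙 (l ≡ᵇ 0))                   ≡⟨ ∑-map len (filterᵇ _ (allFin n)) _ ⟩
      ∑ (filterᵇ _ (allFin n)) (λ ℓ → 𝟙 (len ℓ ≡ᵇ 0))         ≡⟨ ∑-cong (filterᵇ _ (allFin n)) nonzero ⟩
      ∑ (filterᵇ (λ ℓ → isLeader σ ℓ ∧ P ℓ) (allFin n)) (λ _ → 0) ≡⟨ ∑-zero (filterᵇ _ (allFin n)) ⟩
      0                                                         ∎
    where
    open ≡-Reasoning
    nonzero : ∀ ℓ → 𝟙 (len ℓ ≡ᵇ 0) ≡ 0
    nonzero ℓ with len ℓ | cycleLen-pos ℓ
    ... | suc _ | _ = refl

countℕ-∉ : ∀ k xs → k ∉ xs → countℕ k xs ≡ 0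
countℕ-∉ k xs k∉ = trans (length-filterᵇ _ xs) (trans (∑-cong-∈ xs notK) (∑-zero xs))
  where
  notK : ∀ x → x ∈ xs → 𝟙 (x ≡ᵇ k) ≡ 0
  notK x x∈ with x ≡ᵇ k in x≡k
  ... | true  = ⊥-elim (k∉ (subst (_∈ xs) (≡ᵇ⇒≡ x k (≡true⇒T x≡k)) x∈))
  ... | false = refl

sameMultiset-sound : ∀ xs ys → sameMultiset xs ys ≡ true → ∀ k → countℕ k xs ≡ countℕ k ys
sameMultiset-sound xs ys same k with DecMembership._∈?_ _≟_ k (xs ++ ys)
... | yes k∈ = ≡ᵇ⇒≡ _ _ (≡true⇒T (all-sound _ (xs ++ ys) same k∈))
... | no  k∉ = trans (countℕ-∉ k xs (λ p → k∉ (∈-++⁺ˡ p))) (sym (countℕ-∉ k ys (λ p → k∉ (∈-++⁺ʳ xs p))))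

sameMultiset-complete : ∀ xs ys → (∀ k → countℕ k xs ≡ countℕ k ys) → sameMultiset xs ys ≡ true
sameMultiset-complete xs ys counts = all-complete _ (xs ++ ys)
  (λ {k} _ → T⇒≡true (≡⇒≡ᵇ (countℕ k xs) (countℕ k ys) (counts k)))

sameMultiset-congˡ : ∀ xs xs' ys → (∀ k → countℕ k xs ≡ countℕ k xs') → sameMultiset xs ys ≡ sameMultiset xs' ys
sameMultiset-congˡ xs xs' ys counts with sameMultiset xs ys in same | sameMultiset xs' ys in same'
... | true  | true  = refl
... | false | false = refl
... | true  | false = trans (sym (sameMultiset-complete xs' ys (λ k → trans (sym (counts k)) (sameMultiset-sound xs ys same k)))) same'
... | false | true  = trans (sym same) (sameMultiset-complete xs ys (λ k → trans (counts k) (sameMultiset-sound xs' ys same' k)))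

countℕ-cancel : ∀ xs ys → countℕ 0 xs ≡ 0 → countℕ 0 ys ≡ 0 →
  (∀ m → m * countℕ m xs ≡ m * countℕ m ys) → ∀ m → countℕ m xs ≡ countℕ m ys
countℕ-cancel xs ys xs₀ ys₀ weighted zero    = trans xs₀ (sym ys₀)
countℕ-cancel xs ys xs₀ ys₀ weighted (suc m) = *-cancelˡ-≡ _ _ (suc m) (weighted (suc m))

evenNeg : ∀ {n} → Raw n → Fin n → Bool
evenNeg ω k = evenᵇ (negCount ω k)

oddNeg : ∀ {n} → Raw n → Fin n → Bool
oddNeg ω k = not (evenNeg ω k)

module CycleType {n : ℕ} (ω : Raw n) (ω-inj : Injective _≡_ _≡_ (absPart ω)) where
  open Orbits (absPart ω) ω-inj
  open Leaders (absPart ω) ω-inj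

  negCount-orbit : ∀ k k' → k' ∈ orbit (absPart ω) k → negCount ω k' ≡ negCount ω k
  negCount-orbit k k' k'∈ = trans (length-filterᵇ _ (orbit (absPart ω) k'))
    (trans (sym (∑-orbit-cong k'∈ _)) (sym (length-filterᵇ _ (orbit (absPart ω) k))))

  count-evenCycleLengths : ∀ m → m * countℕ m (evenCycleLengths ω) ≡ cyclePoints (absPart ω) (evenNeg ω) m
  count-evenCycleLengths = count-cycleLengths (evenNeg ω) (λ k k' k'∈ → cong evenᵇ (negCount-orbit k k' k'∈))

  count-oddCycleLengths : ∀ m → m * countℕ m (oddCycleLengths ω) ≡ cyclePoints (absPart ω) (oddNeg ω) m
  count-oddCycleLengths = count-cycleLengths (oddNeg ω) (λ k k' k'∈ → cong (λ c → not (evenᵇ c)) (negCount-orbit k k' k'∈))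

  countℕ-zero-even : countℕ 0 (evenCycleLengths ω) ≡ 0
  countℕ-zero-even = countℕ-zero-cycleLengths (evenNeg ω)

  countℕ-zero-odd : countℕ 0 (oddCycleLengths ω) ≡ 0
  countℕ-zero-odd = countℕ-zero-cycleLengths (oddNeg ω)

hasCycleType-cong : ∀ {n} la mu (ω ω' : Raw n) → Injective _≡_ _≡_ (absPart ω) → Injective _≡_ _≡_ (absPart ω') →
  (∀ m → cyclePoints (absPart ω) (evenNeg ω) m ≡ cyclePoints (absPart ω') (evenNeg ω') m) →
  (∀ m → cyclePoints (absPart ω) (oddNeg ω) m ≡ cyclePoints (absPart ω') (oddNeg ω') m) →
  hasCycleType la mu ω ≡ hasCycleType la mu ω'
hasCycleType-cong la mu ω ω' inj inj' evens odds = cong₂ _∧_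
  (sameMultiset-congˡ (evenCycleLengths ω) (evenCycleLengths ω') la
    (countℕ-cancel (evenCycleLengths ω) (evenCycleLengths ω') C.countℕ-zero-even C'.countℕ-zero-even
      (λ m → trans (C.count-evenCycleLengths m) (trans (evens m) (sym (C'.count-evenCycleLengths m))))))
  (sameMultiset-congˡ (oddCycleLengths ω) (oddCycleLengths ω') mu
    (countℕ-cancel (oddCycleLengths ω) (oddCycleLengths ω') C.countℕ-zero-odd C'.countℕ-zero-odd
      (λ m → trans (C.count-oddCycleLengths m) (trans (odds m) (sym (C'.count-oddCycleLengths m))))))
  where
  module C  = CycleType ω inj
  module C' = CycleType ω' inj'

module Embedding {m n : ℕ} (φ : Fin m → Fin n) (φ-inj : Injective _≡_ _≡_ φ) (m≤n : m ≤ n)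
                 (ω₀ : Raw m) (ω₀-inj : Injective _≡_ _≡_ (absPart ω₀)) (ω₁ : Raw n)
                 (absPart-φ : ∀ x → absPart ω₁ (φ x) ≡ φ (absPart ω₀ x))
                 (negAt-φ : ∀ x → negAt ω₁ (φ x) ≡ negAt ω₀ x) where
  private
    σ = absPart ω₀
    τ = absPart ω₁
  open Orbits σ ω₀-inj

  iter-φ : ∀ t k → iter τ t (φ k) ≡ φ (iter σ t k)
  iter-φ zero    k = refl
  iter-φ (suc t) k = trans (cong τ (iter-φ t k)) (absPart-φ (iter σ t k))

  returnsAt-φ : ∀ k t → returnsAt τ (φ k) t ≡ returnsAt σ k t
  returnsAt-φ k t rewrite iter-φ t k with φ (iter σ t k) ≟ᶠ φ k | iter σ t k ≟ᶠ k
  ... | yes _ | yes _ = refl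
  ... | no  _ | no  _ = refl
  ... | yes e | no ≢  = ⊥-elim (≢ (φ-inj e))
  ... | no ≢  | yes e = ⊥-elim (≢ (cong φ e))

  cycleLen-φ : ∀ k → cycleLen τ (φ k) ≡ len k
  cycleLen-φ k = begin
      cycleLen τ (φ k)                   ≡⟨ cycleLen-search τ (φ k) ⟩
      search (returnsAt τ (φ k)) n 1     ≡⟨ search-cong _ _ n 1 (returnsAt-φ k) ⟩
      search (returnsAt σ k) n 1         ≡⟨ search-first (returnsAt σ k) n 1 (len k) returned (cycleLen-pos k) len<1+n earlier ⟩
      len k                              ∎
    where
    open ≡-Reasoning
    returned : returnsAt σ k (len k) ≡ true
    returned = dec-true (iter σ (len k) k ≟ᶠ k) (iter-cycleLen k)
    len<1+n : len k < n + 1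
    len<1+n = subst (len k <_) (+-comm 1 n) (s≤s (≤-trans (cycleLen-≤ k) m≤n))
    earlier : ∀ u → 1 ≤ u → u < len k → returnsAt σ k u ≡ false
    earlier u 1≤u u<len = dec-false (iter σ u k ≟ᶠ k) (iter-<cycleLen k u 1≤u u<len)

  orbit-φ : ∀ k → orbit τ (φ k) ≡ map φ (orbit σ k)
  orbit-φ k rewrite cycleLen-φ k = trans (map-cong (λ t → iter-φ t k) (upTo (len k))) (map-∘ (upTo (len k)))

  negCount-φ : ∀ k → negCount ω₁ (φ k) ≡ negCount ω₀ k
  negCount-φ k = begin
      negCount ω₁ (φ k)                                ≡⟨ length-filterᵇ _ (orbit τ (φ k)) ⟩
      ∑ (orbit τ (φ k)) (λ x → 𝟙 (negAt ω₁ x))         ≡⟨ cong (λ xs → ∑ xs (λ x → 𝟙 (negAt ω₁ x))) (orbit-φ k) ⟩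
      ∑ (map φ (orbit σ k)) (λ x → 𝟙 (negAt ω₁ x))     ≡⟨ ∑-map φ (orbit σ k) _ ⟩
      ∑ (orbit σ k) (λ x → 𝟙 (negAt ω₁ (φ x)))         ≡⟨ ∑-cong (orbit σ k) (λ x → cong 𝟙 (negAt-φ x)) ⟩
      ∑ (orbit σ k) (λ x → 𝟙 (negAt ω₀ x))             ≡⟨ sym (length-filterᵇ _ (orbit σ k)) ⟩
      negCount ω₀ k                                    ∎
    where open ≡-Reasoning

isFixed : ∀ {n} → Raw n → Fin n → Bool
isFixed ω j = does (absPart ω j ≟ᶠ j)

module Conjugation {n : ℕ} (π : Fin n → Fin n) (π-involutive : ∀ x → π (π x) ≡ x) where
  π-inj : Injective _≡_ _≡_ π
  π-inj {a} {b} e = trans (sym (π-involutive a)) (trans (cong π e) (π-involutive b))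

  ∑-reindex : (f : Fin n → ℕ) → ∑ (allFin n) (λ k → f (π k)) ≡ ∑ (allFin n) f
  ∑-reindex f = trans (sym (∑-map π (allFin n) f))
    (∑-Unique.∑-sameMembers _≟ᶠ_ (map π (allFin n)) (allFin n) f (map⁺ π-inj (allFin⁺ n)) (allFin⁺ n)
      (λ z _ → ∈-allFin z) (λ z _ → subst (_∈ map π (allFin n)) (π-involutive z) (∈-map⁺ π (∈-allFin (π z)))))

  conj : Raw n → Raw n
  conj ω = tabulate (λ k → π (absPart ω (π k))) , tabulate (λ k → negAt ω (π k))

  absPart-conj : ∀ ω x → absPart (conj ω) x ≡ π (absPart ω (π x))
  absPart-conj ω = lookup∘tabulate _

  negAt-conj : ∀ ω x → negAt (conj ω) x ≡ negAt ω (π x)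
  negAt-conj ω = lookup∘tabulate _

  conj-involutive : ∀ ω → conj (conj ω) ≡ ω
  conj-involutive (v , s) = cong₂ _,_
    (trans (tabulate-cong (λ k → trans (cong π (absPart-conj (v , s) (π k))) (trans (π-involutive _) (cong (lookup v) (π-involutive k)))))
      (tabulate∘lookup v))
    (trans (tabulate-cong (λ k → trans (negAt-conj (v , s) (π k)) (cong (lookup s) (π-involutive k)))) (tabulate∘lookup s))

  conj-injective : ∀ ω → Injective _≡_ _≡_ (absPart ω) → Injective _≡_ _≡_ (absPart (conj ω))
  conj-injective ω inj {a} {b} e = π-inj (inj (π-inj (trans (sym (absPart-conj ω a)) (trans e (absPart-conj ω b)))))

  module ConjEmbedding (ω : Raw n) (inj : Injective _≡_ _≡_ (absPart ω)) = Embedding π π-inj ≤-refl ω inj (conj ω)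
    (λ x → trans (absPart-conj ω (π x)) (cong (λ z → π (absPart ω z)) (π-involutive x)))
    (λ x → trans (negAt-conj ω (π x)) (cong (negAt ω) (π-involutive x)))

  cyclePoints-conj : ∀ ω → Injective _≡_ _≡_ (absPart ω) → (P : Raw n → Fin n → Bool) →
    (∀ k → P (conj ω) (π k) ≡ P ω k) → ∀ m → cyclePoints (absPart (conj ω)) (P (conj ω)) m ≡ cyclePoints (absPart ω) (P ω) m
  cyclePoints-conj ω inj P P-conj m = trans (sym (∑-reindex _)) (∑-cong (allFin n) atπ)
    where
    atπ : ∀ k → 𝟙 ((cycleLen (absPart (conj ω)) (π k) ≡ᵇ m) ∧ P (conj ω) (π k)) ≡ 𝟙 ((cycleLen (absPart ω) k ≡ᵇ m) ∧ P ω k)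
    atπ k rewrite ConjEmbedding.cycleLen-φ ω inj k | P-conj k = refl

  does-π : ∀ x y → does (π x ≟ᶠ y) ≡ does (x ≟ᶠ π y)
  does-π x y with π x ≟ᶠ y | x ≟ᶠ π y
  ... | yes _  | yes _  = refl
  ... | no  _  | no  _  = refl
  ... | yes πx≡y | no x≢πy = ⊥-elim (x≢πy (trans (sym (π-involutive x)) (cong π πx≡y)))
  ... | no πx≢y  | yes x≡πy = ⊥-elim (πx≢y (trans (cong π x≡πy) (π-involutive y)))

  isFixed-conj : ∀ ω x → isFixed (conj ω) x ≡ isFixed ω (π x)
  isFixed-conj ω x = trans (cong (λ y → does (y ≟ᶠ x)) (absPart-conj ω x)) (does-π (absPart ω (π x)) x)

  hasCycleType-conj : ∀ la mu ω → Injective _≡_ _≡_ (absPart ω) → hasCycleType la mu (conj ω) ≡ hasCycleType la mu ω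
  hasCycleType-conj la mu ω inj = hasCycleType-cong la mu (conj ω) ω (conj-injective ω inj) inj
    (cyclePoints-conj ω inj evenNeg (λ k → cong evenᵇ (ConjEmbedding.negCount-φ ω inj k)))
    (cyclePoints-conj ω inj oddNeg (λ k → cong (λ c → not (evenᵇ c)) (ConjEmbedding.negCount-φ ω inj k)))

Unique-concatMap : {A B : Set} (f : A → List B) (xs : List A) → Unique xs → (∀ x → Unique (f x)) →
  (∀ {x y z} → z ∈ f x → z ∈ f y → x ≡ y) → Unique (concatMap f xs)
Unique-concatMap f []       _            _        _        = []
Unique-concatMap f (x ∷ xs) (x∉xs ∷ uxs) unique-f disjoint = ++⁺ (unique-f x) (Unique-concatMap f xs uxs unique-f disjoint) apart
  where
  apart : ∀ {z} → ¬ (z ∈ f x × z ∈ concatMap f xs)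
  apart (z∈fx , z∈rest) with find (∈-concatMap⁻ f z∈rest)
  ... | y , y∈xs , z∈fy = All¬⇒¬Any x∉xs (subst (_∈ xs) (sym (disjoint z∈fx z∈fy)) y∈xs)

Unique-allVec : {A : Set} (xs : List A) (k : ℕ) → Unique xs → Unique (allVec xs k)
Unique-allVec xs zero    _   = [] ∷ []
Unique-allVec xs (suc k) uxs = Unique-concatMap (λ x → map (x ∷_) (allVec xs k)) xs uxs
  (λ x → map⁺ (λ e → Data.Vec.Properties.∷-injectiveʳ e) (Unique-allVec xs k uxs)) sameHead
  where
  import Data.Vec.Properties
  sameHead : ∀ {x y z} → z ∈ map (x ∷_) (allVec xs k) → z ∈ map (y ∷_) (allVec xs k) → x ≡ y
  sameHead {x} {y} p q with ∈-map⁻ (x ∷_) p | ∈-map⁻ (y ∷_) q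
  ... | _ , _ , refl | _ , _ , e = Data.Vec.Properties.∷-injectiveˡ e

∈-allVec : {A : Set} (xs : List A) → (∀ a → a ∈ xs) → ∀ k (v : Vec A k) → v ∈ allVec xs k
∈-allVec xs complete zero    []      = here refl
∈-allVec xs complete (suc k) (a ∷ v) =
  ∈-concatMap⁺ (λ x → map (x ∷_) (allVec xs k)) (lose (complete a) (∈-map⁺ (a ∷_) (∈-allVec xs complete k v)))

module SignedPermutations (n : ℕ) where
  bools : List Bool
  bools = true ∷ false ∷ []

  ∈-bools : ∀ b → b ∈ bools
  ∈-bools true  = here refl
  ∈-bools false = there (here refl)

  raws : List (Raw n)
  raws = concatMap (λ v → map (v ,_) (allVec bools n)) (allVec (allFin n) n)

  Unique-raws : Unique raws
  Unique-raws = Unique-concatMap _ (allVec (allFin n) n) (Unique-allVec (allFin n) n (allFin⁺ n))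
    (λ v → map⁺ (cong proj₂) (Unique-allVec bools n (((λ ()) ∷ []) ∷ [] ∷ [])))
    sameVec
    where
    sameVec : ∀ {v w z} → z ∈ map (v ,_) (allVec bools n) → z ∈ map (w ,_) (allVec bools n) → v ≡ w
    sameVec {v} {w} p q with ∈-map⁻ (v ,_) p | ∈-map⁻ (w ,_) q
    ... | _ , _ , refl | _ , _ , e = cong proj₁ e

  ∈-raws : ∀ ω → ω ∈ raws
  ∈-raws (v , s) = ∈-concatMap⁺ (λ v → map (v ,_) (allVec bools n))
    (lose (∈-allVec (allFin n) ∈-allFin n v) (∈-map⁺ (v ,_) (∈-allVec bools ∈-bools n s)))

  Unique-Bn : Unique (Bn n)
  Unique-Bn = filter⁺ (λ ω → Data.Bool.T? (isSignedPerm ω)) Unique-raws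
    where import Data.Bool

  ∈Bn⇒isSignedPerm : ∀ {ω} → ω ∈ Bn n → isSignedPerm ω ≡ true
  ∈Bn⇒isSignedPerm ω∈ = T⇒≡true (proj₂ (∈-filter⁻ (λ ω → Data.Bool.T? (isSignedPerm ω)) {xs = raws} ω∈))
    where import Data.Bool

  isSignedPerm⇒∈Bn : ∀ {ω} → isSignedPerm ω ≡ true → ω ∈ Bn n
  isSignedPerm⇒∈Bn {ω} sp = ∈-filter⁺ (λ ω → Data.Bool.T? (isSignedPerm ω)) (∈-raws ω) (≡true⇒T sp)
    where import Data.Bool

  _≟ʳ_ : DecidableEquality (Raw n)
  _≟ʳ_ = Data.Product.Properties.≡-dec (Data.Vec.Properties.≡-dec _≟ᶠ_) (Data.Vec.Properties.≡-dec Data.Bool.Properties._≟_)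
    where
    import Data.Product.Properties
    import Data.Vec.Properties
    import Data.Bool.Properties

  ∑-Bn-involution : (Φ : Raw n → Raw n) → (∀ ω → Φ (Φ ω) ≡ ω) → (∀ ω → isSignedPerm ω ≡ true → isSignedPerm (Φ ω) ≡ true) →
    (F : Raw n → ℕ) → ∑ (Bn n) (λ ω → F (Φ ω)) ≡ ∑ (Bn n) F
  ∑-Bn-involution Φ Φ-involutive Φ-pres F = trans (sym (∑-map Φ (Bn n) F))
    (∑-Unique.∑-sameMembers _≟ʳ_ (map Φ (Bn n)) (Bn n) F (map⁺ Φ-inj Unique-Bn) Unique-Bn
      (λ z z∈ → image z∈) (λ z z∈ → subst (_∈ map Φ (Bn n)) (Φ-involutive z) (∈-map⁺ Φ (image (∈-map⁺ Φ z∈)))))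
    where
    Φ-inj : Injective _≡_ _≡_ Φ
    Φ-inj {a} {b} e = trans (sym (Φ-involutive a)) (trans (cong Φ e) (Φ-involutive b))
    image : ∀ {z} → z ∈ map Φ (Bn n) → z ∈ Bn n
    image z∈ with ∈-map⁻ Φ z∈
    ... | w , w∈ , refl = isSignedPerm⇒∈Bn (Φ-pres w (∈Bn⇒isSignedPerm w∈))

isSignedPerm⇒injective : ∀ {n} (ω : Raw n) → isSignedPerm ω ≡ true → Injective _≡_ _≡_ (absPart ω)
isSignedPerm⇒injective {n} (v , s) sp {a} {b} va≡vb = does-sound (a ≟ᶠ b)
  (subst (λ c → (not c ∨ does (a ≟ᶠ b)) ≡ true) (dec-true (lookup v a ≟ᶠ lookup v b) va≡vb) entry)
  where
  entry : (not (does (lookup v a ≟ᶠ lookup v b)) ∨ does (a ≟ᶠ b)) ≡ true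
  entry = all-sound _ (allFin n) (all-sound _ (allFin n) sp (∈-allFin a)) (∈-allFin b)

injective⇒isSignedPerm : ∀ {n} (ω : Raw n) → Injective _≡_ _≡_ (absPart ω) → isSignedPerm ω ≡ true
injective⇒isSignedPerm {n} (v , s) inj = all-complete _ (allFin n) (λ {a} _ → all-complete _ (allFin n) (λ {b} _ → entry a b))
  where
  entry : ∀ a b → (not (does (lookup v a ≟ᶠ lookup v b)) ∨ does (a ≟ᶠ b)) ≡ true
  entry a b with lookup v a ≟ᶠ lookup v b
  ... | no  _     = refl
  ... | yes va≡vb rewrite dec-true (a ≟ᶠ b) (inj va≡vb) = refl

parity : {A : Set} → List A → (A → Bool) → Bool
parity []       p = false
parity (x ∷ xs) p = p x xor parity xs p

evenᵇ-suc : ∀ m → evenᵇ (suc m) ≡ not (evenᵇ m)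
evenᵇ-suc zero          = refl
evenᵇ-suc (suc zero)    = refl
evenᵇ-suc (suc (suc m)) = evenᵇ-suc m

evenᵇ-length-filterᵇ : {A : Set} (p : A → Bool) (xs : List A) → evenᵇ (length (filterᵇ p xs)) ≡ not (parity xs p)
evenᵇ-length-filterᵇ p []       = refl
evenᵇ-length-filterᵇ p (x ∷ xs) with p x
... | true  = trans (evenᵇ-suc (length (filterᵇ p xs))) (cong not (evenᵇ-length-filterᵇ p xs))
... | false = evenᵇ-length-filterᵇ p xs

parity-cong : {A : Set} (xs : List A) {p q : A → Bool} → (∀ x → p x ≡ q x) → parity xs p ≡ parity xs q
parity-cong []       p≗q = refl
parity-cong (x ∷ xs) p≗q = cong₂ _xor_ (p≗q x) (parity-cong xs p≗q)

parity-xor : {A : Set} (xs : List A) (p q : A → Bool) → parity xs (λ x → p x xor q x) ≡ parity xs p xor parity xs q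
parity-xor []       p q = refl
parity-xor (x ∷ xs) p q = trans (cong ((p x xor q x) xor_) (parity-xor xs p q)) (xor-interchange (p x) (q x) (parity xs p) (parity xs q))
  where
  open import Algebra.Bundles using (CommutativeRing)
  open import Data.Bool.Properties using (xor-∧-commutativeRing)
  open import Algebra.Properties.CommutativeSemigroup (CommutativeRing.+-commutativeSemigroup xor-∧-commutativeRing)
    renaming (interchange to xor-interchange)

parity-≟ : ∀ {n} (xs : List (Fin n)) a → Unique xs →
  parity xs (λ x → does (x ≟ᶠ a)) ≡ does (DecMembership._∈?_ _≟ᶠ_ a xs)
parity-≟ []       a _            = refl
parity-≟ (x ∷ xs) a (x∉xs ∷ uxs) rewrite parity-≟ xs a uxs with x ≟ᶠ a | a ≟ᶠ x | DecMembership._∈?_ _≟ᶠ_ a xs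
... | yes refl | _      | yes a∈ = ⊥-elim (All¬⇒¬Any x∉xs a∈)
... | yes refl | yes _  | no  _  = refl
... | yes refl | no a≢a | no  _  = ⊥-elim (a≢a refl)
... | no  x≢a  | yes e  | _      = ⊥-elim (x≢a (sym e))
... | no  _    | no  _  | yes _  = refl
... | no  _    | no  _  | no  _  = refl

filterᵇ-cong : {A : Set} {p q : A → Bool} (xs : List A) → (∀ x → p x ≡ q x) → filterᵇ p xs ≡ filterᵇ q xs
filterᵇ-cong {p = p} {q} []       p≗q = refl
filterᵇ-cong {p = p} {q} (x ∷ xs) p≗q with p x | q x | p≗q x
... | true  | true  | _ = cong (x ∷_) (filterᵇ-cong xs p≗q)
... | false | false | _ = filterᵇ-cong xs p≗q

-- The toggled set {i, b}, b the preimage of i under |ω|, meets every cycle in an even number of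
-- points (b lies on the cycle of i); when i is not fixed, b ≠ i, so the sign at i flips.
module SignToggle {n : ℕ} (i : Fin n) where
  open import Data.List.Membership.DecPropositional (_≟ᶠ_ {n}) using (_∈?_)

  preimage : Raw n → Fin n
  preimage ω = iter (absPart ω) (cycleLen (absPart ω) i ∸ 1) i

  toggled : Raw n → Fin n → Bool
  toggled ω x = does (x ≟ᶠ i) xor does (x ≟ᶠ preimage ω)

  toggle : Raw n → Raw n
  toggle ω = proj₁ ω , tabulate (λ x → negAt ω x xor toggled ω x)

  negAt-toggle : ∀ ω x → negAt (toggle ω) x ≡ negAt ω x xor toggled ω x
  negAt-toggle ω = lookup∘tabulate _

  toggle-involutive : ∀ ω → toggle (toggle ω) ≡ ω
  toggle-involutive (v , s) = cong (v ,_) (trans (tabulate-cong undo) (tabulate∘lookup s))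
    where
    undo : ∀ x → negAt (toggle (v , s)) x xor toggled (v , s) x ≡ lookup s x
    undo x = begin
      negAt (toggle (v , s)) x xor toggled (v , s) x              ≡⟨ cong (_xor toggled (v , s) x) (negAt-toggle (v , s) x) ⟩
      (lookup s x xor toggled (v , s) x) xor toggled (v , s) x    ≡⟨ xor-assoc (lookup s x) _ _ ⟩
      lookup s x xor (toggled (v , s) x xor toggled (v , s) x)    ≡⟨ cong (lookup s x xor_) (xor-same (toggled (v , s) x)) ⟩
      lookup s x xor false                                        ≡⟨ xor-identityʳ (lookup s x) ⟩
      lookup s x                                                  ∎
      where open ≡-Reasoning

  module _ (ω : Raw n) (ω-inj : Injective _≡_ _≡_ (absPart ω)) where
    open Orbits (absPart ω) ω-inj
    private
      σ = absPart ω
      b = preimage ω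

    σ-preimage : σ b ≡ i
    σ-preimage = trans (sym (iter-+ σ 1 (len i ∸ 1) i))
      (trans (cong (λ t → iter σ t i) (trans (+-comm 1 (len i ∸ 1)) (m∸n+n≡m (cycleLen-pos i)))) (iter-cycleLen i))

    sameOrbit : ∀ k → does (i ∈? orbit σ k) ≡ does (b ∈? orbit σ k)
    sameOrbit k with i ∈? orbit σ k | b ∈? orbit σ k
    ... | yes _  | yes _  = refl
    ... | no  _  | no  _  = refl
    ... | yes i∈ | no  b∉ = ⊥-elim (b∉ (orbit-trans i∈ (iter-∈orbit i (len i ∸ 1))))
    ... | no  i∉ | yes b∈ = ⊥-elim (i∉ (orbit-trans b∈ (orbit-sym (iter-∈orbit i (len i ∸ 1)))))

    parity-toggled : ∀ k → parity (orbit σ k) (toggled ω) ≡ false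
    parity-toggled k = begin
      parity (orbit σ k) (toggled ω)                                                                  ≡⟨ parity-xor (orbit σ k) _ _ ⟩
      parity (orbit σ k) (λ x → does (x ≟ᶠ i)) xor parity (orbit σ k) (λ x → does (x ≟ᶠ b))         ≡⟨ cong₂ _xor_ (parity-≟ (orbit σ k) i (orbit-unique k)) (parity-≟ (orbit σ k) b (orbit-unique k)) ⟩
      does (i ∈? orbit σ k) xor does (b ∈? orbit σ k)                                               ≡⟨ cong (does (i ∈? orbit σ k) xor_) (sym (sameOrbit k)) ⟩
      does (i ∈? orbit σ k) xor does (i ∈? orbit σ k)                                               ≡⟨ xor-same (does (i ∈? orbit σ k)) ⟩
      false                                                                                         ∎
      where open ≡-Reasoning

    evenNeg-toggle : ∀ k → evenNeg (toggle ω) k ≡ evenNeg ω k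
    evenNeg-toggle k = begin
      evenᵇ (negCount (toggle ω) k)                                        ≡⟨ evenᵇ-length-filterᵇ _ (orbit σ k) ⟩
      not (parity (orbit σ k) (negAt (toggle ω)))                          ≡⟨ cong not (parity-cong (orbit σ k) (negAt-toggle ω)) ⟩
      not (parity (orbit σ k) (λ x → negAt ω x xor toggled ω x))           ≡⟨ cong not (parity-xor (orbit σ k) _ _) ⟩
      not (parity (orbit σ k) (negAt ω) xor parity (orbit σ k) (toggled ω)) ≡⟨ cong (λ c → not (parity (orbit σ k) (negAt ω) xor c)) (parity-toggled k) ⟩
      not (parity (orbit σ k) (negAt ω) xor false)                         ≡⟨ cong not (xor-identityʳ _) ⟩
      not (parity (orbit σ k) (negAt ω))                                   ≡⟨ sym (evenᵇ-length-filterᵇ _ (orbit σ k)) ⟩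
      evenᵇ (negCount ω k)                                                 ∎
      where open ≡-Reasoning

    hasCycleType-toggle : ∀ la mu → hasCycleType la mu (toggle ω) ≡ hasCycleType la mu ω
    hasCycleType-toggle la mu = cong₂ (λ evens odds → sameMultiset evens la ∧ sameMultiset odds mu)
      (cong (map (cycleLen σ)) (filterᵇ-cong (allFin n) (λ k → cong (isLeader σ k ∧_) (evenNeg-toggle k))))
      (cong (map (cycleLen σ)) (filterᵇ-cong (allFin n) (λ k → cong (λ c → isLeader σ k ∧ not c) (evenNeg-toggle k))))

    negAt-toggle-moved : isFixed ω i ≡ false → negAt (toggle ω) i ≡ not (negAt ω i)
    negAt-toggle-moved moved = begin
      negAt (toggle ω) i            ≡⟨ negAt-toggle ω i ⟩
      negAt ω i xor toggled ω i     ≡⟨ cong (λ c → negAt ω i xor (c xor does (i ≟ᶠ b))) (dec-true (i ≟ᶠ i) refl) ⟩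
      negAt ω i xor not (does (i ≟ᶠ b)) ≡⟨ cong (λ c → negAt ω i xor not c) (dec-false (i ≟ᶠ b) i≢b) ⟩
      negAt ω i xor true            ≡⟨ xor-true (negAt ω i) ⟩
      not (negAt ω i)               ∎
      where
      open ≡-Reasoning
      xor-true : ∀ c → c xor true ≡ not c
      xor-true true  = refl
      xor-true false = refl
      i≢b : i ≢ b
      i≢b i≡b with () ← trans (sym moved) (dec-true (σ i ≟ᶠ i) (trans (cong σ i≡b) σ-preimage))

fixedPoints : ∀ {n} → Raw n → (Bool → Bool) → ℕ
fixedPoints {n} ω g = ∑ (allFin n) (λ j → 𝟙 (g (negAt ω j) ∧ isFixed ω j))

module FixedPoints {n : ℕ} (ω : Raw n) where
  private
    σ = absPart ω

  orbit-fixed : ∀ j → isFixed ω j ≡ true → orbit σ j ≡ j ∷ []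
  orbit-fixed j fixed = cong (λ l → map (λ t → iter σ t j) (upTo l)) (cycleLen-fixed σ j fixed)

  isLeader-fixed : ∀ j → isFixed ω j ≡ true → isLeader σ j ≡ true
  isLeader-fixed j fixed rewrite orbit-fixed j fixed = cong (_∧ true) (T⇒≡true (≤⇒≤ᵇ (≤-refl {toℕ j})))

  negCount-fixed : ∀ j → isFixed ω j ≡ true → negCount ω j ≡ 𝟙 (negAt ω j)
  negCount-fixed j fixed rewrite orbit-fixed j fixed with negAt ω j
  ... | true  = refl
  ... | false = refl

  countℕ-one : (pr : ℕ → Bool) (g : Bool → Bool) → (∀ b → pr (𝟙 b) ≡ g b) →
    countℕ 1 (map (cycleLen σ) (filterᵇ (λ ℓ → isLeader σ ℓ ∧ pr (negCount ω ℓ)) (allFin n))) ≡ fixedPoints ω g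
  countℕ-one pr g pr≗g = begin
      countℕ 1 (map (cycleLen σ) leaders)                       ≡⟨ length-filterᵇ _ (map (cycleLen σ) leaders) ⟩
      ∑ (map (cycleLen σ) leaders) (λ l → 𝟙 (l ≡ᵇ 1))           ≡⟨ ∑-map (cycleLen σ) leaders _ ⟩
      ∑ leaders (λ ℓ → 𝟙 (cycleLen σ ℓ ≡ᵇ 1))                   ≡⟨ ∑-filterᵇ _ (allFin n) _ ⟩
      ∑ (allFin n) (λ ℓ → if isLeader σ ℓ ∧ pr (negCount ω ℓ) then 𝟙 (cycleLen σ ℓ ≡ᵇ 1) else 0) ≡⟨ ∑-cong (allFin n) atPoint ⟩
      fixedPoints ω g                                           ∎
    where
    open ≡-Reasoning
    leaders = filterᵇ (λ ℓ → isLeader σ ℓ ∧ pr (negCount ω ℓ)) (allFin n)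
    atPoint : ∀ j → (if isLeader σ j ∧ pr (negCount ω j) then 𝟙 (cycleLen σ j ≡ᵇ 1) else 0) ≡ 𝟙 (g (negAt ω j) ∧ isFixed ω j)
    atPoint j with isFixed ω j in fixed
    ... | false rewrite cycleLen-moved σ j fixed | ∧-zeroʳ (g (negAt ω j)) with isLeader σ j ∧ pr (negCount ω j)
    ...   | true  = refl
    ...   | false = refl
    atPoint j | true rewrite isLeader-fixed j fixed | negCount-fixed j fixed | pr≗g (negAt ω j) | cycleLen-fixed σ j fixed
      with g (negAt ω j)
    ...   | true  = refl
    ...   | false = refl

  countℕ-one-odd : countℕ 1 (oddCycleLengths ω) ≡ fixedPoints ω (λ b → b)
  countℕ-one-odd = countℕ-one (λ c → not (evenᵇ c)) (λ b → b) (λ { true → refl ; false → refl })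

  countℕ-one-even : countℕ 1 (evenCycleLengths ω) ≡ fixedPoints ω not
  countℕ-one-even = countℕ-one evenᵇ not (λ { true → refl ; false → refl })

swap : ∀ {n} → Fin n → Fin n → Fin n → Fin n
swap a b k = if does (k ≟ᶠ a) then b else (if does (k ≟ᶠ b) then a else k)

swap-left : ∀ {n} (a b : Fin n) → swap a b a ≡ b
swap-left a b rewrite dec-true (a ≟ᶠ a) refl = refl

swap-right : ∀ {n} (a b : Fin n) → swap a b b ≡ a
swap-right a b with b ≟ᶠ a
... | yes b≡a = b≡a
... | no  _   rewrite dec-true (b ≟ᶠ b) refl = refl

swap-involutive : ∀ {n} (a b k : Fin n) → swap a b (swap a b k) ≡ k
swap-involutive a b k with k ≟ᶠ a
... | yes refl = swap-right k b
... | no  k≢a with k ≟ᶠ b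
...   | yes refl = swap-left a k
...   | no  k≢b rewrite dec-false (k ≟ᶠ a) k≢a | dec-false (k ≟ᶠ b) k≢b = refl

module Counting (n : ℕ) (la mu : List ℕ) (i : Fin n) where
  open SignedPermutations n

  inClass : Raw n → Bool
  inClass = hasCycleType la mu

  classSize : ℕ
  classSize = ∑ (Bn n) (λ ω → 𝟙 (inClass ω))

  negativeAt : ℕ
  negativeAt = ∑ (Bn n) (λ ω → 𝟙 (inClass ω ∧ negAt ω i))

  fixedWith : (Bool → Bool) → Fin n → ℕ
  fixedWith g j = ∑ (Bn n) (λ ω → 𝟙 (inClass ω ∧ (g (negAt ω j) ∧ isFixed ω j)))

  movedWith : (Bool → Bool) → ℕ
  movedWith g = ∑ (Bn n) (λ ω → 𝟙 (inClass ω ∧ (g (negAt ω i) ∧ not (isFixed ω i))))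

  length-conjClass : length (conjClass n la mu) ≡ classSize
  length-conjClass = length-filterᵇ inClass (Bn n)

  length-negatives : length (filterᵇ (λ ω → negAt ω i) (conjClass n la mu)) ≡ negativeAt
  length-negatives = trans (length-filterᵇ _ (conjClass n la mu)) (trans (∑-filterᵇ inClass (Bn n) _) (∑-cong (Bn n) restrict))
    where
    restrict : ∀ ω → (if inClass ω then 𝟙 (negAt ω i) else 0) ≡ 𝟙 (inClass ω ∧ negAt ω i)
    restrict ω with inClass ω
    ... | true  = refl
    ... | false = refl

  negativeAt-split : negativeAt ≡ fixedWith (λ b → b) i + movedWith (λ b → b)
  negativeAt-split = trans (∑-cong (Bn n) (λ ω → split (inClass ω) (negAt ω i) (isFixed ω i))) (∑-+ (Bn n) _ _)
    where
    split : ∀ c s f → 𝟙 (c ∧ s) ≡ 𝟙 (c ∧ (s ∧ f)) + 𝟙 (c ∧ (s ∧ not f))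
    split true  true  true  = refl
    split true  true  false = refl
    split true  false _     = refl
    split false _     _     = refl

  classSize-split : classSize ≡ negativeAt + (fixedWith not i + movedWith not)
  classSize-split = trans (∑-cong (Bn n) (λ ω → split (inClass ω) (negAt ω i) (isFixed ω i)))
    (trans (∑-+ (Bn n) _ _) (cong (negativeAt +_) (∑-+ (Bn n) _ _)))
    where
    split : ∀ c s f → 𝟙 c ≡ 𝟙 (c ∧ s) + (𝟙 (c ∧ (not s ∧ f)) + 𝟙 (c ∧ (not s ∧ not f)))
    split true  true  _     = refl
    split true  false true  = refl
    split true  false false = refl
    split false _     _     = refl

  movedWith-toggle : movedWith (λ b → b) ≡ movedWith not
  movedWith-toggle = trans (∑-cong-∈ (Bn n) atToggled) (∑-Bn-involution toggle toggle-involutive (λ ω sp → sp) _)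
    where
    open SignToggle i
    atToggled : ∀ ω → ω ∈ Bn n →
      𝟙 (inClass ω ∧ (negAt ω i ∧ not (isFixed ω i))) ≡ 𝟙 (inClass (toggle ω) ∧ (not (negAt (toggle ω) i) ∧ not (isFixed ω i)))
    atToggled ω ω∈ rewrite hasCycleType-toggle ω (isSignedPerm⇒injective ω (∈Bn⇒isSignedPerm ω∈)) la mu with isFixed ω i in fixed
    ... | true  = cong (λ c → 𝟙 (inClass ω ∧ c)) (trans (∧-zeroʳ (negAt ω i)) (sym (∧-zeroʳ (not (negAt (toggle ω) i)))))
    ... | false rewrite negAt-toggle-moved ω (isSignedPerm⇒injective ω (∈Bn⇒isSignedPerm ω∈)) fixed
                      | not-involutive (negAt ω i) = refl

  fixedWith-swap : ∀ g j → fixedWith g j ≡ fixedWith g i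
  fixedWith-swap g j = trans (sym (∑-Bn-involution conj conj-involutive conj-pres _)) (∑-cong-∈ (Bn n) atSwapped)
    where
    open Conjugation (swap i j) (swap-involutive i j)
    conj-pres : ∀ ω → isSignedPerm ω ≡ true → isSignedPerm (conj ω) ≡ true
    conj-pres ω sp = injective⇒isSignedPerm (conj ω) (conj-injective ω (isSignedPerm⇒injective ω sp))
    atSwapped : ∀ ω → ω ∈ Bn n →
      𝟙 (inClass (conj ω) ∧ (g (negAt (conj ω) j) ∧ isFixed (conj ω) j)) ≡ 𝟙 (inClass ω ∧ (g (negAt ω i) ∧ isFixed ω i))
    atSwapped ω ω∈ rewrite hasCycleType-conj la mu ω (isSignedPerm⇒injective ω (∈Bn⇒isSignedPerm ω∈))
                         | isFixed-conj ω j | negAt-conj ω j | swap-right i j = refl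

  -- Double counting of pairs (ω, j) with j fixed by ω; by fixedWith-swap each j counts as much as i.
  fixedWith-total : ∀ g c → (∀ ω → inClass ω ≡ true → fixedPoints ω g ≡ c) → n * fixedWith g i ≡ classSize * c
  fixedWith-total g c perClass = begin
      n * fixedWith g i                                     ≡⟨ *-comm n (fixedWith g i) ⟩
      fixedWith g i * n                                     ≡⟨ cong (fixedWith g i *_) (sym (length-tabulate (λ x → x))) ⟩
      fixedWith g i * length (allFin n)                     ≡⟨ sym (∑-const (allFin n) (fixedWith g i)) ⟩
      ∑ (allFin n) (λ _ → fixedWith g i)                    ≡⟨ sym (∑-cong (allFin n) (fixedWith-swap g)) ⟩
      ∑ (allFin n) (fixedWith g)                            ≡⟨ ∑-comm (allFin n) (Bn n) _ ⟩
      ∑ (Bn n) (λ ω → ∑ (allFin n) (λ j → 𝟙 (inClass ω ∧ (g (negAt ω j) ∧ isFixed ω j)))) ≡⟨ ∑-cong (Bn n) perElement ⟩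
      ∑ (Bn n) (λ ω → c * 𝟙 (inClass ω))                    ≡⟨ ∑-distribˡ c (Bn n) _ ⟩
      c * classSize                                         ≡⟨ *-comm c classSize ⟩
      classSize * c                                         ∎
    where
    open ≡-Reasoning
    perElement : ∀ ω → ∑ (allFin n) (λ j → 𝟙 (inClass ω ∧ (g (negAt ω j) ∧ isFixed ω j))) ≡ c * 𝟙 (inClass ω)
    perElement ω with inClass ω in class
    ... | true  = trans (perClass ω class) (sym (*-identityʳ c))
    ... | false = trans (∑-zero (allFin n)) (sym (*-zeroʳ c))

  fixedNegatives : n * fixedWith (λ b → b) i ≡ classSize * m₁ mu
  fixedNegatives = fixedWith-total (λ b → b) (m₁ mu) (λ ω class →
    trans (sym (FixedPoints.countℕ-one-odd ω)) (sameMultiset-sound (oddCycleLengths ω) mu (∧-conjunctʳ class) 1))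

  fixedPositives : n * fixedWith not i ≡ classSize * m₁ la
  fixedPositives = fixedWith-total not (m₁ la) (λ ω class →
    trans (sym (FixedPoints.countℕ-one-even ω)) (sameMultiset-sound (evenCycleLengths ω) la (∧-conjunctˡ class) 1))

  balance : 2 * n * negativeAt + classSize * m₁ la ≡ n * classSize + classSize * m₁ mu
  balance = begin
      2 * n * negativeAt + classSize * m₁ la   ≡⟨ cong₂ (λ x y → 2 * n * x + y) negativeAt-split (sym fixedPositives) ⟩
      2 * n * (a + c) + n * b                  ≡⟨ rearrange n a b c ⟩
      n * ((a + c) + (b + c)) + n * a          ≡⟨ cong₂ _+_ (cong (n *_) (sym classSize-blocks)) fixedNegatives ⟩
      n * classSize + classSize * m₁ mu        ∎
    where
    open ≡-Reasoning
    a = fixedWith (λ s → s) i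
    b = fixedWith not i
    c = movedWith (λ s → s)
    classSize-blocks : classSize ≡ (a + c) + (b + c)
    classSize-blocks = trans classSize-split (cong₂ (λ x y → x + (b + y)) negativeAt-split (sym movedWith-toggle))
    rearrange : ∀ n a b c → 2 * n * (a + c) + n * b ≡ n * ((a + c) + (b + c)) + n * a
    rearrange = solve-∀
      where open import Data.Nat.Tactic.RingSolver using (solve-∀)

∑-tabulate : ∀ {A : Set} {n} (g : Fin n → A) (f : A → ℕ) → ∑ (Data.List.tabulate g) f ≡ ∑ (allFin n) (λ j → f (g j))
∑-tabulate {n = zero}  g f = refl
∑-tabulate {n = suc n} g f = cong (f (g zero) +_)
  (trans (∑-tabulate (λ j → g (suc j)) f) (sym (∑-tabulate suc (λ j → f (g j)))))

∑-allFin-+ : ∀ m k (h : Fin (m + k) → ℕ) → ∑ (allFin (m + k)) h ≡ ∑ (allFin m) (λ r → h (r ↑ˡ k)) + ∑ (allFin k) (λ j → h (m ↑ʳ j))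
∑-allFin-+ zero    k h = refl
∑-allFin-+ (suc m) k h = begin
    h zero + ∑ (Data.List.tabulate suc) h                                         ≡⟨ cong (h zero +_) (∑-tabulate suc h) ⟩
    h zero + ∑ (allFin (m + k)) (λ j → h (suc j))                                 ≡⟨ cong (h zero +_) (∑-allFin-+ m k (λ j → h (suc j))) ⟩
    h zero + (∑ (allFin m) (λ r → h (suc r ↑ˡ k)) + ∑ (allFin k) (λ j → h (suc m ↑ʳ j))) ≡⟨ sym (+-assoc (h zero) _ _) ⟩
    h zero + ∑ (allFin m) (λ r → h (suc r ↑ˡ k)) + ∑ (allFin k) (λ j → h (suc m ↑ʳ j)) ≡⟨ cong (λ s → h zero + s + ∑ (allFin k) (λ j → h (suc m ↑ʳ j))) (sym (∑-tabulate {n = m} suc (λ r → h (r ↑ˡ k)))) ⟩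
    ∑ (allFin (suc m)) (λ r → h (r ↑ˡ k)) + ∑ (allFin k) (λ j → h (suc m ↑ʳ j))   ∎
  where open ≡-Reasoning

rotate : ∀ a → Fin (suc a) → Fin (suc a)
rotate a zero    = fromℕ a
rotate a (suc r) = inject₁ r

rotate-injective : ∀ a → Injective _≡_ _≡_ (rotate a)
rotate-injective a {zero}  {zero}  _ = refl
rotate-injective a {suc x} {suc y} e = cong suc (inject₁-injective e)
rotate-injective a {zero}  {suc y} e = ⊥-elim (<-irrefl (trans (sym (toℕ-inject₁ y)) (trans (cong toℕ (sym e)) (toℕ-fromℕ a))) (toℕ<n y))
rotate-injective a {suc x} {zero}  e = ⊥-elim (<-irrefl (trans (sym (toℕ-inject₁ x)) (trans (cong toℕ e) (toℕ-fromℕ a))) (toℕ<n x))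

toℕ-rotate : ∀ a (x : Fin (suc a)) c → toℕ x ≡ suc c → toℕ (rotate a x) ≡ c
toℕ-rotate a (suc r) c e = trans (toℕ-inject₁ r) (suc-injective e)

signAtZero : ∀ {a} → Bool → Fin (suc a) → Bool
signAtZero e zero    = e
signAtZero e (suc _) = false

module Cycle (a : ℕ) (e : Bool) where
  ω : Raw (suc a)
  ω = tabulate (rotate a) , tabulate (signAtZero e)

  private
    σ = absPart ω

  absPart-ω : ∀ x → σ x ≡ rotate a x
  absPart-ω = lookup∘tabulate (rotate a)

  ω-inj : Injective _≡_ _≡_ σ
  ω-inj {x} {y} σx≡σy = rotate-injective a (trans (sym (absPart-ω x)) (trans σx≡σy (absPart-ω y)))

  open Orbits σ ω-inj
  open import Data.List.Membership.DecPropositional (_≟ᶠ_ {suc a}) using (_∈?_)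

  toℕ-iter : ∀ t → t ≤ a → toℕ (iter σ t (fromℕ a)) ≡ a ∸ t
  toℕ-iter zero    _   = toℕ-fromℕ a
  toℕ-iter (suc t) t<a = trans (cong toℕ (absPart-ω (iter σ t (fromℕ a))))
    (toℕ-rotate a (iter σ t (fromℕ a)) (a ∸ suc t) (trans (toℕ-iter t (<⇒≤ t<a)) (+-∸-assoc 1 t<a)))

  ∈orbit-top : ∀ j → j ∈ orbit σ (fromℕ a)
  ∈orbit-top j = subst (_∈ orbit σ (fromℕ a)) reached (iter-∈orbit (fromℕ a) (a ∸ toℕ j))
    where
    reached : iter σ (a ∸ toℕ j) (fromℕ a) ≡ j
    reached = toℕ-injective (trans (toℕ-iter (a ∸ toℕ j) (m∸n≤m a (toℕ j))) (m∸[m∸n]≡n (≤-pred (toℕ<n j))))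

  ∑-orbit-all : ∀ k (f : Fin (suc a) → ℕ) → ∑ (orbit σ k) f ≡ ∑ (allFin (suc a)) f
  ∑-orbit-all k f = trans (∑-orbit k f) (∑-cong (allFin (suc a)) everywhere)
    where
    everywhere : ∀ j → (if does (j ∈? orbit σ k) then f j else 0) ≡ f j
    everywhere j rewrite dec-true (j ∈? orbit σ k) (orbit-trans (orbit-sym (∈orbit-top k)) (∈orbit-top j)) = refl

  cycleLen-ω : ∀ k → cycleLen σ k ≡ suc a
  cycleLen-ω k = begin
    cycleLen σ k                      ≡⟨ sym (length-orbit k) ⟩
    length (orbit σ k)                ≡⟨ sym (∑-one (orbit σ k)) ⟩
    ∑ (orbit σ k) (λ _ → 1)           ≡⟨ ∑-orbit-all k (λ _ → 1) ⟩
    ∑ (allFin (suc a)) (λ _ → 1)      ≡⟨ ∑-one (allFin (suc a)) ⟩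
    length (allFin (suc a))           ≡⟨ length-tabulate (λ x → x) ⟩
    suc a                             ∎
    where open ≡-Reasoning

  negCount-ω : ∀ k → negCount ω k ≡ 𝟙 e
  negCount-ω k = begin
    negCount ω k                                              ≡⟨ length-filterᵇ (negAt ω) (orbit σ k) ⟩
    ∑ (orbit σ k) (λ x → 𝟙 (negAt ω x))                       ≡⟨ ∑-orbit-all k _ ⟩
    ∑ (allFin (suc a)) (λ x → 𝟙 (negAt ω x))                  ≡⟨ ∑-cong (allFin (suc a)) (λ x → cong 𝟙 (lookup∘tabulate (signAtZero e) x)) ⟩
    ∑ (allFin (suc a)) (λ x → 𝟙 (signAtZero e x))             ≡⟨ cong (𝟙 e +_) (trans (∑-tabulate {n = a} suc (λ x → 𝟙 (signAtZero e x))) (∑-zero (allFin a))) ⟩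
    𝟙 e + 0                                                   ≡⟨ +-identityʳ (𝟙 e) ⟩
    𝟙 e                                                       ∎
    where open ≡-Reasoning

  cyclePoints-ω : (pr : ℕ → Bool) → ∀ m → cyclePoints σ (λ k → pr (negCount ω k)) m ≡ suc a * 𝟙 ((suc a ≡ᵇ m) ∧ pr (𝟙 e))
  cyclePoints-ω pr m = begin
    cyclePoints σ (λ k → pr (negCount ω k)) m                      ≡⟨ ∑-cong (allFin (suc a)) (λ k → cong₂ (λ l c → 𝟙 ((l ≡ᵇ m) ∧ pr c)) (cycleLen-ω k) (negCount-ω k)) ⟩
    ∑ (allFin (suc a)) (λ _ → 𝟙 ((suc a ≡ᵇ m) ∧ pr (𝟙 e)))         ≡⟨ ∑-const (allFin (suc a)) _ ⟩
    𝟙 ((suc a ≡ᵇ m) ∧ pr (𝟙 e)) * length (allFin (suc a))          ≡⟨ cong (𝟙 ((suc a ≡ᵇ m) ∧ pr (𝟙 e)) *_) (length-tabulate (λ x → x)) ⟩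
    𝟙 ((suc a ≡ᵇ m) ∧ pr (𝟙 e)) * suc a                            ≡⟨ *-comm _ (suc a) ⟩
    suc a * 𝟙 ((suc a ≡ᵇ m) ∧ pr (𝟙 e))                            ∎
    where open ≡-Reasoning

_⊕_ : ∀ {p q} → (Fin p → Fin p) → (Fin q → Fin q) → Fin (p + q) → Fin (p + q)
_⊕_ {p} {q} σ₁ σ₂ k = join p q (Data.Sum.map σ₁ σ₂ (splitAt p k))

⊕-↑ˡ : ∀ {p q} (σ₁ : Fin p → Fin p) (σ₂ : Fin q → Fin q) r → (σ₁ ⊕ σ₂) (r ↑ˡ q) ≡ σ₁ r ↑ˡ q
⊕-↑ˡ {p} {q} σ₁ σ₂ r rewrite splitAt-↑ˡ p r q = refl

⊕-↑ʳ : ∀ {p q} (σ₁ : Fin p → Fin p) (σ₂ : Fin q → Fin q) j → (σ₁ ⊕ σ₂) (p ↑ʳ j) ≡ p ↑ʳ σ₂ j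
⊕-↑ʳ {p} {q} σ₁ σ₂ j rewrite splitAt-↑ʳ p q j = refl

⊕-injective : ∀ {p q} (σ₁ : Fin p → Fin p) (σ₂ : Fin q → Fin q) →
  Injective _≡_ _≡_ σ₁ → Injective _≡_ _≡_ σ₂ → Injective _≡_ _≡_ (σ₁ ⊕ σ₂)
⊕-injective {p} {q} σ₁ σ₂ σ₁-inj σ₂-inj {a} {b} e = begin
    a                                  ≡⟨ sym (join-splitAt p q a) ⟩
    join p q (splitAt p a)             ≡⟨ cong (join p q) (map-injective (splitAt p a) (splitAt p b) mapped) ⟩
    join p q (splitAt p b)             ≡⟨ join-splitAt p q b ⟩
    b                                  ∎
  where
  open ≡-Reasoning
  open import Data.Sum.Properties using (inj₁-injective; inj₂-injective)
  mapped : Data.Sum.map σ₁ σ₂ (splitAt p a) ≡ Data.Sum.map σ₁ σ₂ (splitAt p b)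
  mapped = trans (sym (splitAt-join p q _)) (trans (cong (splitAt p) e) (splitAt-join p q _))
  map-injective : ∀ x y → Data.Sum.map σ₁ σ₂ x ≡ Data.Sum.map σ₁ σ₂ y → x ≡ y
  map-injective (inj₁ x) (inj₁ y) e = cong inj₁ (σ₁-inj (inj₁-injective e))
  map-injective (inj₂ x) (inj₂ y) e = cong inj₂ (σ₂-inj (inj₂-injective e))

_⊕ᵇ_ : ∀ {p q} → (Fin p → Bool) → (Fin q → Bool) → Fin (p + q) → Bool
_⊕ᵇ_ {p} f₁ f₂ k = [ f₁ , f₂ ]′ (splitAt p k)

⊕ᵇ-↑ˡ : ∀ {p q} (f₁ : Fin p → Bool) (f₂ : Fin q → Bool) r → (f₁ ⊕ᵇ f₂) (r ↑ˡ q) ≡ f₁ r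
⊕ᵇ-↑ˡ {p} {q} f₁ f₂ r rewrite splitAt-↑ˡ p r q = refl

⊕ᵇ-↑ʳ : ∀ {p q} (f₁ : Fin p → Bool) (f₂ : Fin q → Bool) j → (f₁ ⊕ᵇ f₂) (p ↑ʳ j) ≡ f₂ j
⊕ᵇ-↑ʳ {p} {q} f₁ f₂ j rewrite splitAt-↑ʳ p q j = refl

-- A block (a , e) is a cycle of length suc a that is odd iff e.
blocksSize : List (ℕ × Bool) → ℕ
blocksSize bs = ∑ bs (λ b → suc (proj₁ b))

blocksPerm : ∀ bs → Fin (blocksSize bs) → Fin (blocksSize bs)
blocksPerm []             k = k
blocksPerm ((a , e) ∷ bs)   = rotate a ⊕ blocksPerm bs

blocksSigns : ∀ bs → Fin (blocksSize bs) → Bool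
blocksSigns []             _ = false
blocksSigns ((a , e) ∷ bs)   = signAtZero e ⊕ᵇ blocksSigns bs

blocksRaw : ∀ bs → Raw (blocksSize bs)
blocksRaw bs = tabulate (blocksPerm bs) , tabulate (blocksSigns bs)

blocksPerm-injective : ∀ bs → Injective _≡_ _≡_ (blocksPerm bs)
blocksPerm-injective []             e = e
blocksPerm-injective ((a , _) ∷ bs)   = ⊕-injective (rotate a) (blocksPerm bs) (rotate-injective a) (blocksPerm-injective bs)

blocksRaw-injective : ∀ bs → Injective _≡_ _≡_ (absPart (blocksRaw bs))
blocksRaw-injective bs {x} {y} e =
  blocksPerm-injective bs (trans (sym (lookup∘tabulate (blocksPerm bs) x)) (trans e (lookup∘tabulate (blocksPerm bs) y)))

blockWeight : (ℕ → Bool) → ℕ → ℕ × Bool → ℕ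
blockWeight pr m (a , e) = suc a * 𝟙 ((suc a ≡ᵇ m) ∧ pr (𝟙 e))

cyclePoints-blocks : ∀ bs (pr : ℕ → Bool) m →
  cyclePoints (absPart (blocksRaw bs)) (λ k → pr (negCount (blocksRaw bs) k)) m ≡ ∑ bs (blockWeight pr m)
cyclePoints-blocks []             pr m = refl
cyclePoints-blocks ((a , e) ∷ bs) pr m = begin
    ∑ (allFin (suc a + rest)) h                                         ≡⟨ ∑-allFin-+ (suc a) rest h ⟩
    ∑ (allFin (suc a)) (λ r → h (r ↑ˡ rest)) + ∑ (allFin rest) (λ j → h (suc a ↑ʳ j)) ≡⟨ cong₂ _+_ (∑-cong (allFin (suc a)) left) (∑-cong (allFin rest) right) ⟩
    cyclePoints (absPart (Cycle.ω a e)) (λ k → pr (negCount (Cycle.ω a e) k)) m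
      + cyclePoints (absPart (blocksRaw bs)) (λ k → pr (negCount (blocksRaw bs) k)) m ≡⟨ cong₂ _+_ (Cycle.cyclePoints-ω a e pr m) (cyclePoints-blocks bs pr m) ⟩
    blockWeight pr m (a , e) + ∑ bs (blockWeight pr m)                ∎
  where
  open ≡-Reasoning
  rest = blocksSize bs
  ω = blocksRaw ((a , e) ∷ bs)
  h : Fin (suc a + rest) → ℕ
  h k = 𝟙 ((cycleLen (absPart ω) k ≡ᵇ m) ∧ pr (negCount ω k))
  module Left = Embedding (_↑ˡ rest) (λ {x} {y} → ↑ˡ-injective rest x y) (m≤m+n (suc a) rest) (Cycle.ω a e) (Cycle.ω-inj a e) ω
    (λ x → trans (lookup∘tabulate (blocksPerm ((a , e) ∷ bs)) (x ↑ˡ rest)) (trans (⊕-↑ˡ (rotate a) (blocksPerm bs) x) (cong (_↑ˡ rest) (sym (Cycle.absPart-ω a e x)))))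
    (λ x → trans (lookup∘tabulate (blocksSigns ((a , e) ∷ bs)) (x ↑ˡ rest)) (trans (⊕ᵇ-↑ˡ (signAtZero {a} e) (blocksSigns bs) x) (sym (lookup∘tabulate (signAtZero e) x))))
  module Right = Embedding (suc a ↑ʳ_) (λ {x} {y} → ↑ʳ-injective (suc a) x y) (m≤n+m rest (suc a)) (blocksRaw bs) (blocksRaw-injective bs) ω
    (λ x → trans (lookup∘tabulate (blocksPerm ((a , e) ∷ bs)) (suc a ↑ʳ x)) (trans (⊕-↑ʳ (rotate a) (blocksPerm bs) x) (cong (suc a ↑ʳ_) (sym (lookup∘tabulate (blocksPerm bs) x)))))
    (λ x → trans (lookup∘tabulate (blocksSigns ((a , e) ∷ bs)) (suc a ↑ʳ x)) (trans (⊕ᵇ-↑ʳ (signAtZero {a} e) (blocksSigns bs) x) (sym (lookup∘tabulate (blocksSigns bs) x))))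
  left : ∀ r → h (r ↑ˡ rest) ≡ 𝟙 ((cycleLen (absPart (Cycle.ω a e)) r ≡ᵇ m) ∧ pr (negCount (Cycle.ω a e) r))
  left r = cong₂ (λ l c → 𝟙 ((l ≡ᵇ m) ∧ pr c)) (Left.cycleLen-φ r) (Left.negCount-φ r)
  right : ∀ j → h (suc a ↑ʳ j) ≡ 𝟙 ((cycleLen (absPart (blocksRaw bs)) j ≡ᵇ m) ∧ pr (negCount (blocksRaw bs) j))
  right j = cong₂ (λ l c → 𝟙 ((l ≡ᵇ m) ∧ pr c)) (Right.cycleLen-φ j) (Right.negCount-φ j)

∑-weighted-count : ∀ xs m → ∑ xs (λ l → l * 𝟙 (l ≡ᵇ m)) ≡ m * countℕ m xs
∑-weighted-count xs m = begin
    ∑ xs (λ l → l * 𝟙 (l ≡ᵇ m))   ≡⟨ ∑-cong xs atM ⟩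
    ∑ xs (λ l → m * 𝟙 (l ≡ᵇ m))   ≡⟨ ∑-distribˡ m xs _ ⟩
    m * ∑ xs (λ l → 𝟙 (l ≡ᵇ m))   ≡⟨ cong (m *_) (sym (length-filterᵇ _ xs)) ⟩
    m * countℕ m xs               ∎
  where
  open ≡-Reasoning
  atM : ∀ l → l * 𝟙 (l ≡ᵇ m) ≡ m * 𝟙 (l ≡ᵇ m)
  atM l with l ≡ᵇ m in l≡m
  ... | true  = cong (_* 1) (≡ᵇ⇒≡ l m (≡true⇒T l≡m))
  ... | false = trans (*-zeroʳ l) (sym (*-zeroʳ m))

positiveBlocks : Bool → List ℕ → List (ℕ × Bool)
positiveBlocks e = map (λ l → (pred l , e))

∑-positiveBlocks : ∀ e la → All (1 ≤_) la → ∀ pr m →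
  ∑ (positiveBlocks e la) (blockWeight pr m) ≡ (if pr (𝟙 e) then m * countℕ m la else 0)
∑-positiveBlocks e la pos pr m = trans (∑-map _ la _) (trans (∑-cong-∈ la unpred) byParity)
  where
  unpred : ∀ l → l ∈ la → blockWeight pr m (pred l , e) ≡ l * 𝟙 ((l ≡ᵇ m) ∧ pr (𝟙 e))
  unpred l l∈ with All.lookup pos l∈
  ... | s≤s _ = refl
  byParity : ∑ la (λ l → l * 𝟙 ((l ≡ᵇ m) ∧ pr (𝟙 e))) ≡ (if pr (𝟙 e) then m * countℕ m la else 0)
  byParity with pr (𝟙 e)
  ... | true  = trans (∑-cong la (λ l → cong (λ c → l * 𝟙 c) (∧-identityʳ (l ≡ᵇ m)))) (∑-weighted-count la m)
  ... | false = trans (∑-cong la (λ l → trans (cong (λ c → l * 𝟙 c) (∧-zeroʳ (l ≡ᵇ m))) (*-zeroʳ l))) (∑-zero la)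

blocksSize-positiveBlocks : ∀ e la → All (1 ≤_) la → blocksSize (positiveBlocks e la) ≡ sum la
blocksSize-positiveBlocks e []          []      = refl
blocksSize-positiveBlocks e (suc l ∷ la) (_ ∷ pos) = cong (suc l +_) (blocksSize-positiveBlocks e la pos)

countℕ-zero-positive : ∀ la → All (1 ≤_) la → countℕ 0 la ≡ 0
countℕ-zero-positive []           []        = refl
countℕ-zero-positive (suc l ∷ la) (_ ∷ pos) = countℕ-zero-positive la pos

module Realisation (la mu : List ℕ) (la-pos : All (1 ≤_) la) (mu-pos : All (1 ≤_) mu) where
  blocks : List (ℕ × Bool)
  blocks = positiveBlocks false la ++ positiveBlocks true mu

  ω : Raw (blocksSize blocks)
  ω = blocksRaw blocks

  private
    module C = CycleType ω (blocksRaw-injective blocks)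

  cyclePoints-ω : ∀ (pr : ℕ → Bool) m → cyclePoints (absPart ω) (λ k → pr (negCount ω k)) m
    ≡ (if pr 0 then m * countℕ m la else 0) + (if pr 1 then m * countℕ m mu else 0)
  cyclePoints-ω pr m = trans (cyclePoints-blocks blocks pr m) (trans (∑-++ (positiveBlocks false la) (positiveBlocks true mu) _)
    (cong₂ _+_ (∑-positiveBlocks false la la-pos pr m) (∑-positiveBlocks true mu mu-pos pr m)))

  hasCycleType-ω : hasCycleType la mu ω ≡ true
  hasCycleType-ω = cong₂ _∧_
    (sameMultiset-complete (evenCycleLengths ω) la (countℕ-cancel (evenCycleLengths ω) la C.countℕ-zero-even (countℕ-zero-positive la la-pos)
      (λ m → trans (C.count-evenCycleLengths m) (trans (cyclePoints-ω evenᵇ m) (+-identityʳ (m * countℕ m la))))))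
    (sameMultiset-complete (oddCycleLengths ω) mu (countℕ-cancel (oddCycleLengths ω) mu C.countℕ-zero-odd (countℕ-zero-positive mu mu-pos)
      (λ m → trans (C.count-oddCycleLengths m) (cyclePoints-ω (λ c → not (evenᵇ c)) m))))

  blocksSize-ω : blocksSize blocks ≡ sum la + sum mu
  blocksSize-ω = trans (∑-++ (positiveBlocks false la) (positiveBlocks true mu) _)
    (cong₂ _+_ (blocksSize-positiveBlocks false la la-pos) (blocksSize-positiveBlocks true mu mu-pos))

conjClass-nonempty : ∀ n la mu → All (1 ≤_) la → All (1 ≤_) mu → sum la + sum mu ≡ n →
  1 ≤ ∑ (Bn n) (λ ω → 𝟙 (hasCycleType la mu ω))
conjClass-nonempty n la mu la-pos mu-pos total = subst P (trans blocksSize-ω total)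
  (subst (λ c → 𝟙 c ≤ ∑ (Bn N) (λ ω′ → 𝟙 (hasCycleType la mu ω′))) hasCycleType-ω
    (∑-∈-≤ (Bn N) (λ ω′ → 𝟙 (hasCycleType la mu ω′)) (SignedPermutations.isSignedPerm⇒∈Bn N {ω} (injective⇒isSignedPerm ω (blocksRaw-injective blocks)))))
  where
  open Realisation la mu la-pos mu-pos
  N : ℕ
  N = blocksSize blocks
  P : ℕ → Set
  P k = 1 ≤ ∑ (Bn k) (λ ω′ → 𝟙 (hasCycleType la mu ω′))

frac-half-minus : ∀ A N n l m → 1 ≤ N → 2 * suc n * A + N * l ≡ suc n * N + N * m →
  frac (ℤ.+ A) N ≡ ½ - frac (ℤ.+ l ℤ.- ℤ.+ m) (2 * suc n)
frac-half-minus A (suc N) n l m _ balanced = trans (ℚ.fromℚᵘ-cong crossMultiplied) (sym (-≡fromℚᵘ ½ y))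
  where
  open import Data.Integer using (+_; -_) renaming (_+_ to _+ℤ_; _*_ to _*ℤ_; _-_ to _-ℤ_)
  import Data.Integer.Properties as ℤP
  import Data.Rational as ℚ
  import Data.Rational.Properties as ℚ
  open import Data.Rational.Unnormalised using (mkℚᵘ; *≡*) renaming (_-_ to _-ᵘ_; _≃_ to _≃ᵘ_)
  import Data.Rational.Unnormalised.Properties as ℚᵘ
  open import Data.Integer.Tactic.RingSolver using (solve-∀)
  open ≡-Reasoning

  -≡fromℚᵘ : ∀ p q → p - q ≡ ℚ.fromℚᵘ (ℚ.toℚᵘ p -ᵘ ℚ.toℚᵘ q)
  -≡fromℚᵘ p q = trans (sym (ℚ.fromℚᵘ-toℚᵘ (p - q)))
    (ℚ.fromℚᵘ-cong (ℚᵘ.≃-trans (ℚ.toℚᵘ-homo-+ p (ℚ.- q)) (ℚᵘ.+-cong {ℚ.toℚᵘ p} ℚᵘ.≃-refl (ℚ.toℚᵘ-homo‿- q))))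

  d = + l -ℤ + m
  y = frac d (2 * suc n)

  integerBalance : + 2 *ℤ + suc n *ℤ + A +ℤ + suc N *ℤ + l ≡ + suc n *ℤ + suc N +ℤ + suc N *ℤ + m
  integerBalance = begin
    + 2 *ℤ + suc n *ℤ + A +ℤ + suc N *ℤ + l  ≡⟨ cong₂ _+ℤ_ (trans (cong (_*ℤ + A) (sym (ℤP.pos-* 2 (suc n)))) (sym (ℤP.pos-* (2 * suc n) A))) (sym (ℤP.pos-* (suc N) l)) ⟩
    + (2 * suc n * A) +ℤ + (suc N * l)       ≡⟨ sym (ℤP.pos-+ (2 * suc n * A) (suc N * l)) ⟩
    + (2 * suc n * A + suc N * l)            ≡⟨ cong +_ balanced ⟩
    + (suc n * suc N + suc N * m)            ≡⟨ ℤP.pos-+ (suc n * suc N) (suc N * m) ⟩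
    + (suc n * suc N) +ℤ + (suc N * m)       ≡⟨ cong₂ _+ℤ_ (ℤP.pos-* (suc n) (suc N)) (ℤP.pos-* (suc N) m) ⟩
    + suc n *ℤ + suc N +ℤ + suc N *ℤ + m     ∎

  doubled : ∀ a n N l → a *ℤ (+ 2 *ℤ (+ 2 *ℤ n)) ≡ + 2 *ℤ (+ 2 *ℤ n *ℤ a +ℤ N *ℤ l) -ℤ + 2 *ℤ (N *ℤ l)
  doubled = solve-∀

  regrouped : ∀ n N l m → + 2 *ℤ (n *ℤ N +ℤ N *ℤ m) -ℤ + 2 *ℤ (N *ℤ l) ≡ (+ 1 *ℤ (+ 2 *ℤ n) +ℤ (- (l -ℤ m)) *ℤ + 2) *ℤ N
  regrouped = solve-∀

  -- the cross-multiplication identity 4n·A = (2n − 2d)·N for A/N = 1/2 − d/(2n)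
  cross : + A *ℤ + (2 * (2 * suc n)) ≡ (+ 1 *ℤ + (2 * suc n) +ℤ (- d) *ℤ + 2) *ℤ + suc N
  cross = begin
    + A *ℤ + (2 * (2 * suc n))                                        ≡⟨ cong (+ A *ℤ_) (trans (ℤP.pos-* 2 (2 * suc n)) (cong (+ 2 *ℤ_) (ℤP.pos-* 2 (suc n)))) ⟩
    + A *ℤ (+ 2 *ℤ (+ 2 *ℤ + suc n))                                  ≡⟨ doubled (+ A) (+ suc n) (+ suc N) (+ l) ⟩
    + 2 *ℤ (+ 2 *ℤ + suc n *ℤ + A +ℤ + suc N *ℤ + l) -ℤ + 2 *ℤ (+ suc N *ℤ + l) ≡⟨ cong (λ z → + 2 *ℤ z -ℤ + 2 *ℤ (+ suc N *ℤ + l)) integerBalance ⟩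
    + 2 *ℤ (+ suc n *ℤ + suc N +ℤ + suc N *ℤ + m) -ℤ + 2 *ℤ (+ suc N *ℤ + l) ≡⟨ regrouped (+ suc n) (+ suc N) (+ l) (+ m) ⟩
    (+ 1 *ℤ (+ 2 *ℤ + suc n) +ℤ (- d) *ℤ + 2) *ℤ + suc N               ≡⟨ cong (λ z → (+ 1 *ℤ z +ℤ (- d) *ℤ + 2) *ℤ + suc N) (sym (ℤP.pos-* 2 (suc n))) ⟩
    (+ 1 *ℤ + (2 * suc n) +ℤ (- d) *ℤ + 2) *ℤ + suc N                  ∎

  crossMultiplied : mkℚᵘ (+ A) N ≃ᵘ (ℚ.toℚᵘ ½ -ᵘ ℚ.toℚᵘ y)
  crossMultiplied = ℚᵘ.≃-trans (*≡* cross)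
    (ℚᵘ.≃-sym (ℚᵘ.+-cong {ℚ.toℚᵘ ½} ℚᵘ.≃-refl (ℚᵘ.-‿cong (ℚ.toℚᵘ-fromℚᵘ (mkℚᵘ d (n + suc (n + 0)))))))

proposition4p13 : (n : ℕ) (la mu : List ℕ)
    → All (1 ≤_) la → All (1 ≤_) mu → sum la + sum mu ≡ n
    → (i : Fin n)
    → probNeg n la mu i ≡ ½ - frac (Δ¹ la mu) (2 * n)
proposition4p13 (suc n) la mu la-pos mu-pos total i = begin
    probNeg (suc n) la mu i           ≡⟨ cong₂ (λ p q → frac (ℤ.+ p) q) length-negatives length-conjClass ⟩
    frac (ℤ.+ negativeAt) classSize   ≡⟨ frac-half-minus negativeAt classSize n (m₁ la) (m₁ mu) nonempty balance ⟩
    ½ - frac (Δ¹ la mu) (2 * suc n)   ∎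
  where
  open Counting (suc n) la mu i
  open ≡-Reasoning
  nonempty : 1 ≤ classSize
  nonempty = conjClass-nonempty (suc n) la mu la-pos mu-pos total
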